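{- For every Turing machine $M=(S_{\mathrm{tm}},\Gamma_{\mathrm{tm}},\Sigma_{\mathrm{tm}},\delta_{\mathrm{tm}},s^0_{\mathrm{tm}},b_{\mathrm{tm}},F_{\mathrm{tm}})$ with an infinite tape and head moves in $\{L,R\}$, there exist finite sets $\mathcal{G}$ (goals) and $\mathcal{R}$ (responses) and an agent function $\chi$ with context capacity $C=2$ such that, when $\chi$ operates on a Quest Graph initialized as a linear chain of nodes encoding the initial tape of $M$ (with the focus node at the head position), the resulting run of the Quest Graph simulates $M$ step by step: after each simulated step the tape contents, head position and current state of $M$ can be read off the Quest Graph, and the agent performs the stop action exactly when $M$ enters an accepting state. In particular, an agent with a finite context size operating on a Quest Graph is Turing complete.
   Context: A Quest Graph is built from a finite set of goals $\mathcal{G}$ and a finite set of responses $\mathcal{R}$ (which may contain an empty symbol $\varepsilon$ meaning "incomplete"); a node configuration is a pair $(g,r)\in\mathcal{V}=\mathcal{G}\times\mathcal{R}$, where the goal $g$ is fixed at the node's creation and the response $r$ may be changed. An instance is a finite undirected graph $(V,E)$ whose nodes carry configurations from $\mathcal{V}$, together with a distinguished focus node $v_f\in V$. For a fixed integer $C\ge 1$ (context capacity), a local context is the configuration of the focus node together with an ordered tuple of the configurations of up to $C$ of its neighbors; the set of local contexts is $\mathcal{V}^{\le C}=\bigcup_{k=0}^{C}\mathcal{V}^{1+k}$. An edge pointer refers to one of the listed neighbors of, or a self-loop on, the focus node. The agent function $\chi$ is a deterministic, stateless map from local contexts to one of three actions: (1) discover node: create a new node with a specified configuration in $\mathcal{V}$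 and connect it to a specified subset of the nodes in the current local context (output in $\mathcal{V}\times\mathcal{E}^{\le C}$); (2) respond then move focus: overwrite the response of the focus node with a specified $r\in\mathcal{R}$ and move the focus along a specified edge pointer (output in $\mathcal{R}\times\mathcal{E}$); (3) stop: halt. The computation repeatedly applies $\chi$ to the current local context; the Quest Graph is the agent's only memory. -}

module Defs where

open import Data.Nat using (ℕ; zero; suc; _≤_; _<_)
open import Data.Nat.Properties using (m⊓n≤m)
open import Data.Fin using (Fin; zero; suc; inject₁; fromℕ; _≟_)
open import Data.Bool using (Bool; true; false; _∧_; _∨_; not; if_then_else_)
open import Data.Maybe using (Maybe; just; nothing; _>>=_)
import Data.Maybe as Maybe
open import Data.List using (List; []; _∷_; length; map; take; drop; filterᵇ; allFin; _++_)
import Data.List as List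
open import Data.Bool.ListAction using (any)
open import Data.List.Properties using (length-take)
open import Data.List.Relation.Unary.Unique.Propositional using (Unique)
open import Data.Vec using (Vec)
import Data.Vec as Vec
open import Data.Product using (Σ; _×_; _,_; proj₁; proj₂; ∃)
open import Data.Unit using (⊤)
open import Function using (_∘_; _⇔_)
open import Relation.Nullary.Decidable using (⌊_⌋)
open import Relation.Binary.PropositionalEquality using (_≡_; subst; sym)

-- S = Fin nS, Γ = Fin nΓ, Σ ⊆ Γ given by its characteristic function,
-- δ is a partial transition function (nothing = undefined), F ⊆ S.

data Move : Set where
  L R : Move

record TM : Set where
  field
    nS nΓ     : ℕ
    inΣ       : Fin nΓ → Bool
    δ         : Fin nS → Fin nΓ → Maybe (Fin nS × Fin nΓ × Move)
    s₀        : Fin nS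
    blank     : Fin nΓ
    blank∉Σ   : inΣ blank ≡ false
    accepting : Fin nS → Bool

-- A configuration: state, tape to the left of the head (nearest cell
-- first), symbol under the head, tape to the right (nearest first).
-- All cells not listed are blank.
record Config (M : TM) : Set where
  constructor conf
  field
    state : Fin (TM.nS M)
    left  : List (Fin (TM.nΓ M))
    head  : Fin (TM.nΓ M)
    right : List (Fin (TM.nΓ M))

module TMSemantics (M : TM) where
  open TM M

  headOr : List (Fin nΓ) → Fin nΓ
  headOr []      = blank
  headOr (x ∷ _) = x

  moveHead : Fin nS → Fin nΓ → Move → Config M → Config M
  moveHead s a L (conf _ l h r) = conf s (drop 1 l) (headOr l) (a ∷ r)
  moveHead s a R (conf _ l h r) = conf s (a ∷ l) (headOr r) (drop 1 r)

  -- one step; nothing = M has halted (accepting state reached, or δ undefined)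
  stepTM : Config M → Maybe (Config M)
  stepTM c =
    if accepting (Config.state c) then nothing
    else Maybe.map (λ t → moveHead (proj₁ t) (proj₁ (proj₂ t)) (proj₂ (proj₂ t)) c)
                   (δ (Config.state c) (Config.head c))

  initConfig : List (Fin nΓ) → Config M
  initConfig w = conf s₀ [] (headOr w) (drop 1 w)

  tmAt : List (Fin nΓ) → ℕ → Maybe (Config M)
  tmAt w zero    = just (initConfig w)
  tmAt w (suc k) = tmAt w k >>= stepTM

  data IsInput : List (Fin nΓ) → Set where
    []  : IsInput []
    _∷_ : ∀ {a w} → inΣ a ≡ true → IsInput w → IsInput (a ∷ w)

-- Quest Graphs with goals 𝒢 = Fin nG, responses ℛ = Fin nR,
-- context capacity C.

module QuestGraph (C nG nR : ℕ) where

  𝒱 : Set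
  𝒱 = Fin nG × Fin nR

  -- Nodes are Fin n, numbered in order of creation.
  record QG : Set where
    field
      n     : ℕ
      cfg   : Fin n → 𝒱
      edges : List (Fin n × Fin n)   -- undirected
      focus : Fin n

  adjB : ∀ {n} → List (Fin n × Fin n) → Fin n → Fin n → Bool
  adjB es a b = any (λ e → (⌊ proj₁ e ≟ a ⌋ ∧ ⌊ proj₂ e ≟ b ⌋) ∨ (⌊ proj₁ e ≟ b ⌋ ∧ ⌊ proj₂ e ≟ a ⌋)) es

  neighbours : (q : QG) → List (Fin (QG.n q))
  neighbours q = filterᵇ (λ u → not ⌊ u ≟ focus ⌋ ∧ adjB edges focus u) (allFin n)
    where open QG q

  record Ctx : Set where
    field
      k    : ℕ
      k≤C  : k ≤ C
      here : 𝒱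
      nbrs : Vec 𝒱 k

  -- edge pointer: nothing = self-loop on the focus, just i = i-th listed neighbour
  Ptr : ℕ → Set
  Ptr k = Maybe (Fin k)

  data Action (k : ℕ) : Set where
    discover : 𝒱 → (ps : List (Ptr k)) → length ps ≤ C → Action k
    respond  : Fin nR → Ptr k → Action k
    stop     : Action k

  Agent : Set
  Agent = (c : Ctx) → Action (Ctx.k c)

  ctxIds : (q : QG) → List (Fin (QG.n q))
  ctxIds q = take C (neighbours q)

  context : QG → Ctx
  context q = record
    { k    = length (ctxIds q)
    ; k≤C  = subst (_≤ C) (sym (length-take C (neighbours q))) (m⊓n≤m C _)
    ; here = QG.cfg q (QG.focus q)
    ; nbrs = Vec.map (QG.cfg q) (Vec.fromList (ctxIds q))
    }

  resolve : (q : QG) → Ptr (length (ctxIds q)) → Fin (QG.n q)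
  resolve q nothing  = QG.focus q
  resolve q (just i) = List.lookup (ctxIds q) i

  snocF : ∀ {n} → (Fin n → 𝒱) → 𝒱 → Fin (suc n) → 𝒱
  snocF {zero}  f v zero    = v
  snocF {suc n} f v zero    = f zero
  snocF {suc n} f v (suc i) = snocF (f ∘ suc) v i

  apply : (q : QG) → Action (length (ctxIds q)) → Maybe QG
  apply q stop = nothing
  apply q (respond r p) = just record
    { n     = QG.n q
    ; cfg   = λ u → if ⌊ u ≟ QG.focus q ⌋ then (proj₁ (QG.cfg q u) , r) else QG.cfg q u
    ; edges = QG.edges q
    ; focus = resolve q p
    }
  apply q (discover v ps _) = just record
    { n     = suc (QG.n q)
    ; cfg   = snocF (QG.cfg q) v
    ; edges = map (λ e → inject₁ (proj₁ e) , inject₁ (proj₂ e)) (QG.edges q)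
              ++ map (λ p → fromℕ (QG.n q) , inject₁ (resolve q p)) ps
    ; focus = inject₁ (QG.focus q)
    }

  step : Agent → QG → Maybe QG
  step χ q = apply q (χ (context q))

  run : Agent → QG → ℕ → Maybe QG
  run χ q₀ zero    = just q₀
  run χ q₀ (suc t) = run χ q₀ t >>= step χ

  chain : {Γ : Set} → (Γ → 𝒱) → Γ → List Γ → QG
  chain enc h rest = record
    { n     = suc (length rest)
    ; cfg   = λ i → enc (Vec.lookup (h Vec.∷ Vec.fromList rest) i)
    ; edges = map (λ i → inject₁ i , suc i) (allFin (length rest))
    ; focus = zero
    }

  Path : ∀ {n} → List (Fin n × Fin n) → List (Fin n) → Set
  Path es []            = ⊤
  Path es (x ∷ [])      = ⊤
  Path es (x ∷ y ∷ xs)  = adjB es x y ≡ true × Path es (y ∷ xs)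

-- lookup with blank padding (tape contents up to trailing blanks)
lookupB : {A : Set} → A → List A → ℕ → A
lookupB b []       i       = b
lookupB b (x ∷ xs) zero    = x
lookupB b (x ∷ xs) (suc i) = lookupB b xs i

TapeEq : {A : Set} → A → List A → List A → Set
TapeEq b xs ys = ∀ i → lookupB b xs i ≡ lookupB b ys i

module Simulation (M : TM) (C nG nR : ℕ) where
  open TM M
  open TMSemantics M
  open QuestGraph C nG nR

  -- the Quest Graph q displays configuration c, read off through the fixed
  -- node-local decoders symOf (tape symbol of a node) and stOf (state,
  -- read from the focus node): there is a simple path through the focus
  -- node whose two halves carry the tape left / right of the head.
  Represents : (symOf : 𝒱 → Fin nΓ) (stOf : 𝒱 → Fin nS) → QG → Config M → Set
  Represents symOf stOf q c =
    Σ (List (Fin n)) λ ls → Σ (List (Fin n)) λ rs →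
      Unique (focus ∷ ls ++ rs)
      × Path edges (focus ∷ ls)
      × Path edges (focus ∷ rs)
      × stOf (cfg focus) ≡ Config.state c
      × symOf (cfg focus) ≡ Config.head c
      × TapeEq blank (map (symOf ∘ cfg) ls) (Config.left c)
      × TapeEq blank (map (symOf ∘ cfg) rs) (Config.right c)
    where open QG q

  StrictMono : (ℕ → ℕ) → Set
  StrictMono τ = ∀ k → τ k < τ (suc k)

  Simulates : Agent → (Fin nΓ → 𝒱) → (𝒱 → Fin nΓ) → (𝒱 → Fin nS) → Set
  Simulates χ initCfg symOf stOf =
    ∀ (w : List (Fin nΓ)) → IsInput w →
      let q₀ = chain initCfg (headOr w) (drop 1 w) in
      Σ (ℕ → ℕ) λ τ →
        StrictMono τ
        × (∀ k c → tmAt w k ≡ just c →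
             Σ QG λ q → run χ q₀ (τ k) ≡ just q × Represents symOf stOf q c)
        × ((Σ ℕ λ T → run χ q₀ T ≡ nothing)
           ⇔ (Σ ℕ λ k → Σ (Config M) λ c → tmAt w k ≡ just c × accepting (Config.state c) ≡ true))

TuringSimulable : TM → Set
TuringSimulable M =
  Σ ℕ λ nG → Σ ℕ λ nR →
  Σ (QuestGraph.Agent 2 nG nR) λ χ →
  Σ (Fin (TM.nΓ M) → QuestGraph.𝒱 2 nG nR) λ initCfg →
  Σ (QuestGraph.𝒱 2 nG nR → Fin (TM.nΓ M)) λ symOf →
  Σ (QuestGraph.𝒱 2 nG nR → Fin (TM.nS M)) λ stOf →
    Simulation.Simulates M 2 nG nR χ initCfg symOf stOf

{-# OPTIONS --safe #-}

-- The agent keeps the Quest Graph a simple path of tape cells with the head cell in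
-- focus; the head cell's response records the state of M.  A local context lists the
-- neighbours only in order of creation, so every node's goal records whether it belongs
-- to the initial chain or was discovered to its left or right: together with the
-- creation order this tells the agent which neighbour lies left.  One step of M takes
-- four agent steps: the head cell marks itself with the chosen transition (or discovers
-- the missing neighbour), turns into a trail pointing at the target cell, the target
-- cell becomes the head, and the trail is cleared.  The resulting invariant (a simple
-- path, goals in order, one active cell, all other cells passive and spelling the tape)
-- holds after 2 + 4k agent steps for the k-th configuration of M; the agent stops
-- exactly at accepting states and idles forever where δ is undefined.

module Submission where

open import Data.Bool using (Bool; true; false; T; not; _∧_; _∨_; if_then_else_)
open import Data.Bool.Properties using (T-≡; T-∧; T-∨)
open import Data.Empty using (⊥-elim)
open import Data.Fin using (Fin; zero; suc; inject₁; fromℕ; _<_)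
open import Data.Fin.Properties
  using (_≟_; +↔⊎; *↔×; 1↔⊤; inject₁-injective; fromℕ≢inject₁; toℕ-inject₁; toℕ-fromℕ; toℕ<n)
  using (<-trans; <-asym; <-cmp)
open import Data.List as List using (List; []; _∷_; [_]; _++_; map; tabulate; allFin)
open import Data.List.Properties
  using (++-identityʳ; map-id; map-∘; map-cong-local; map-tabulate; tabulate-lookup; tabulate-cong)
open import Data.List.Membership.Propositional using (_∈_; _∉_)
open import Data.List.Membership.Propositional.Properties
  using (∈-map⁺; ∈-map⁻; ∈-++⁺ˡ; ∈-++⁺ʳ; ∈-++⁻; ∈-allFin; ∈-filter⁺; ∈-filter⁻)
open import Data.List.Relation.Binary.Permutation.Propositional
  using (_↭_; ↭-refl; ↭-sym; ↭-prep; ↭-swap; ↭⇒↭ₛ)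
open import Data.List.Relation.Binary.Permutation.Propositional.Properties using (shift; ++-comm; Any-resp-↭)
import Data.List.Relation.Binary.Permutation.Setoid.Properties as PermutationSetoid
open import Data.List.Relation.Unary.All as All using (All; []; _∷_)
import Data.List.Relation.Unary.All.Properties as All
open import Data.List.Relation.Unary.AllPairs as AllPairs using ([]; _∷_)
open import Data.List.Relation.Unary.Any as Any using (Any; here; there)
open import Data.List.Relation.Unary.Any.Properties using (any⁺; any⁻; Any-⊎⁺; Any-⊎⁻)
open import Data.List.Relation.Unary.Linked as Linked using (Linked; []; [-]; _∷_)
import Data.List.Relation.Unary.Linked.Properties as Linked
open import Data.List.Relation.Unary.Unique.Propositional using (Unique)
import Data.List.Relation.Unary.Unique.Propositional.Properties as Unique
open import Data.Maybe as Maybe using (Maybe; just; nothing; _>>=_)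
open import Data.Nat as ℕ using (ℕ; zero; suc; s≤s; z≤n; _+_; _*_; _∸_)
open import Data.Nat.Induction using (<-rec)
import Data.Nat.Properties as ℕₚ
open import Data.Product as Product using (∃; ∃₂; _×_; _,_; proj₁; proj₂)
open import Data.Product.Function.NonDependent.Propositional using (_×-⇔_; _×-↔_)
open import Data.Sum as Sum using (_⊎_; inj₁; inj₂; [_,_]′)
open import Data.Sum.Function.Propositional using (_⊎-⇔_; _⊎-↔_)
open import Data.Unit using (⊤; tt)
open import Data.Vec as Vec using (Vec; []; _∷_)
import Data.Vec.Properties as Vec
open import Function using (id; _∘_; _∘′_; flip; case_of_; _⇔_; mk⇔; Equivalence)
open import Function.Bundles using (_↔_; mk↔ₛ′; Inverse)
open import Function.Construct.Composition using (_↔-∘_) renaming (_⇔-∘_ to _∘⇔_)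
open import Function.Construct.Identity using (↔-id)
open import Function.Properties.Equivalence using () renaming (refl to ⇔-refl; sym to ⇔-sym; trans to ⇔-trans)
import Function.Related.Propositional as Related
open import Relation.Binary.Definitions using (Transitive; Asymmetric; tri<; tri≈; tri>)
open import Relation.Binary.PropositionalEquality
  using (_≡_; _≢_; refl; sym; trans; cong; cong₂; subst; subst₂; setoid; module ≡-Reasoning)
open import Relation.Nullary using (¬_)
open import Relation.Nullary.Decidable using (⌊_⌋; yes; no; toWitness; fromWitness; T?)

open import Defs

open Equivalence using (to; from)

-- Lists and simple paths

data Consecutive {A : Set} : A → A → List A → Set where
  now   : ∀ {x y xs} → Consecutive x y (x ∷ y ∷ xs)
  later : ∀ {x y z xs} → Consecutive x y xs → Consecutive x y (z ∷ xs)

module _ {A : Set} where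

  Consecutive⇒∈ˡ : ∀ {x y : A} {xs} → Consecutive x y xs → x ∈ xs
  Consecutive⇒∈ˡ now       = here refl
  Consecutive⇒∈ˡ (later p) = there (Consecutive⇒∈ˡ p)

  Consecutive⇒∈ʳ : ∀ {x y : A} {xs} → Consecutive x y xs → y ∈ xs
  Consecutive⇒∈ʳ now       = there (here refl)
  Consecutive⇒∈ʳ (later p) = there (Consecutive⇒∈ʳ p)

  Consecutive-[-] : ∀ {x y z : A} → ¬ Consecutive x y [ z ]
  Consecutive-[-] (later ())

  Consecutive⇒Linked : ∀ {R : A → A → Set} xs → (∀ {x y} → Consecutive x y xs → R x y) → Linked R xs
  Consecutive⇒Linked []           R-cons = []
  Consecutive⇒Linked (x ∷ [])     R-cons = [-]
  Consecutive⇒Linked (x ∷ y ∷ xs) R-cons = R-cons now ∷ Consecutive⇒Linked (y ∷ xs) (R-cons ∘′ later)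

  private
    Unique-resp-↭ : ∀ {xs ys : List A} → xs ↭ ys → Unique xs → Unique ys
    Unique-resp-↭ = PermutationSetoid.Unique-resp-↭ (setoid A) ∘ ↭⇒↭ₛ

  Unique-shift : ∀ (x : A) ys zs → Unique (x ∷ ys ++ zs) ⇔ Unique (ys ++ x ∷ zs)
  Unique-shift x ys zs = mk⇔ (Unique-resp-↭ (↭-sym (shift x ys zs))) (Unique-resp-↭ (shift x ys zs))

  Unique-swap : ∀ (x : A) ys zs → Unique (x ∷ ys ++ zs) → Unique (x ∷ zs ++ ys)
  Unique-swap x ys zs = Unique-resp-↭ (↭-prep x (++-comm ys zs))

module _ {A B : Set} (g : A → B) where

  Consecutive-map⁺ : ∀ {x y xs} → Consecutive x y xs → Consecutive (g x) (g y) (map g xs)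
  Consecutive-map⁺ now       = now
  Consecutive-map⁺ (later p) = later (Consecutive-map⁺ p)

  Consecutive-map⁻ : ∀ xs {a b} → Consecutive a b (map g xs) →
                     ∃₂ λ x y → a ≡ g x × b ≡ g y × Consecutive x y xs
  Consecutive-map⁻ (x ∷ y ∷ xs) now = x , y , refl , refl , now
  Consecutive-map⁻ (x ∷ xs) (later p) with Consecutive-map⁻ xs p
  ... | x′ , y′ , refl , refl , q = x′ , y′ , refl , refl , later q

module _ {A : Set} where

  Consecutive-tabulate : ∀ {m} (g : Fin (suc m) → A) {a b} →
                         Consecutive a b (tabulate g) ⇔ ∃ λ i → a ≡ g (inject₁ i) × b ≡ g (suc i)
  Consecutive-tabulate {zero}  g = mk⇔ (⊥-elim ∘ Consecutive-[-]) (λ ())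
  Consecutive-tabulate {suc m} g = mk⇔ to′ from′
    where
      to′ : ∀ {a b} → Consecutive a b (tabulate g) → ∃ λ i → a ≡ g (inject₁ i) × b ≡ g (suc i)
      to′ now       = zero , refl , refl
      to′ (later p) with to (Consecutive-tabulate (g ∘ suc)) p
      ... | i , refl , refl = suc i , refl , refl
      from′ : ∀ {a b} → (∃ λ i → a ≡ g (inject₁ i) × b ≡ g (suc i)) → Consecutive a b (tabulate g)
      from′ (zero  , refl , refl) = now
      from′ (suc i , refl , refl) = later (from (Consecutive-tabulate (g ∘ suc)) (i , refl , refl))

lastOr : {A : Set} → A → List A → A
lastOr x []       = x
lastOr _ (y ∷ ys) = lastOr y ys

lastOr-map : ∀ {A B : Set} (g : A → B) x ys → lastOr (g x) (map g ys) ≡ g (lastOr x ys)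
lastOr-map g x []       = refl
lastOr-map g x (y ∷ ys) = lastOr-map g y ys

module _ {A : Set} {b : A} where

  TapeEq-≡ : ∀ {xs ys} zs → xs ≡ ys → TapeEq b ys zs → TapeEq b xs zs
  TapeEq-≡ _ refl ys≈zs = ys≈zs

  TapeEq-∷ : ∀ x xs ys → TapeEq b xs ys → TapeEq b (x ∷ xs) (x ∷ ys)
  TapeEq-∷ _ _ _ xs≈ys zero    = refl
  TapeEq-∷ _ _ _ xs≈ys (suc i) = xs≈ys i

  TapeEq-drop : ∀ xs ys → TapeEq b xs ys → TapeEq b (List.drop 1 xs) (List.drop 1 ys)
  TapeEq-drop xs ys xs≈ys i = trans (lookupB-drop xs) (trans (xs≈ys (suc i)) (sym (lookupB-drop ys)))
    where
      lookupB-drop : ∀ zs → lookupB b (List.drop 1 zs) i ≡ lookupB b zs (suc i)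
      lookupB-drop []      = refl
      lookupB-drop (_ ∷ _) = refl

lookup-fromList : ∀ {A : Set} (xs : List A) i → Vec.lookup (Vec.fromList xs) i ≡ List.lookup xs i
lookup-fromList (x ∷ xs) zero    = refl
lookup-fromList (x ∷ xs) (suc i) = lookup-fromList xs i

module _ {A : Set} where

  Joins : List (A × A) → A → A → Set
  Joins es a b = (a , b) ∈ es ⊎ (b , a) ∈ es

  Adjacent : List A → A → A → Set
  Adjacent xs a b = Consecutive a b xs ⊎ Consecutive b a xs

  -- the edges of the path  reverse ls ++ f ∷ rs
  PathEdge : A → List A → List A → A → A → Set
  PathEdge f ls rs a b = Adjacent (f ∷ ls) a b ⊎ Adjacent (f ∷ rs) a b

  PathEdge-swap : ∀ {f : A} {ls rs a b} → PathEdge f ls rs a b → PathEdge f rs ls a b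
  PathEdge-swap = Sum.swap

  PathEdge-moveLeft : ∀ {f l : A} {ls rs a b} → PathEdge f (l ∷ ls) rs a b → PathEdge l ls (f ∷ rs) a b
  PathEdge-moveLeft (inj₁ (inj₁ now))       = inj₂ (inj₂ now)
  PathEdge-moveLeft (inj₁ (inj₁ (later p))) = inj₁ (inj₁ p)
  PathEdge-moveLeft (inj₁ (inj₂ now))       = inj₂ (inj₁ now)
  PathEdge-moveLeft (inj₁ (inj₂ (later p))) = inj₁ (inj₂ p)
  PathEdge-moveLeft (inj₂ (inj₁ p))         = inj₂ (inj₁ (later p))
  PathEdge-moveLeft (inj₂ (inj₂ p))         = inj₂ (inj₂ (later p))

  PathEdge-moveRight : ∀ {f r : A} {ls rs a b} → PathEdge f ls (r ∷ rs) a b → PathEdge r (f ∷ ls) rs a b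
  PathEdge-moveRight = PathEdge-swap ∘ PathEdge-moveLeft ∘ PathEdge-swap

  PathEdge-[]ʳ : ∀ {f : A} {ls a b} → PathEdge f ls [] a b ⇔ Adjacent (f ∷ ls) a b
  PathEdge-[]ʳ = mk⇔ [ id , ⊥-elim ∘ [ Consecutive-[-] , Consecutive-[-] ]′ ]′ inj₁

  Adjacent-pair : ∀ {x y a b : A} → Adjacent (x ∷ [ y ]) a b ⇔ Joins [ (y , x) ] a b
  Adjacent-pair = mk⇔ to′ from′
    where
      to′ : ∀ {x y a b : A} → Adjacent (x ∷ [ y ]) a b → Joins [ (y , x) ] a b
      to′ (inj₁ now)       = inj₂ (here refl)
      to′ (inj₁ (later p)) = ⊥-elim (Consecutive-[-] p)
      to′ (inj₂ now)       = inj₁ (here refl)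
      to′ (inj₂ (later p)) = ⊥-elim (Consecutive-[-] p)
      from′ : ∀ {x y a b : A} → Joins [ (y , x) ] a b → Adjacent (x ∷ [ y ]) a b
      from′ (inj₁ (here refl)) = inj₂ now
      from′ (inj₂ (here refl)) = inj₁ now

  Joins-++ : ∀ es {es′} {a b : A} → Joins (es ++ es′) a b ⇔ (Joins es a b ⊎ Joins es′ a b)
  Joins-++ es = mk⇔ to′ from′
    where
      to′ : ∀ {es′ a b} → Joins (es ++ es′) a b → Joins es a b ⊎ Joins es′ a b
      to′ (inj₁ p) = Sum.map inj₁ inj₁ (∈-++⁻ es p)
      to′ (inj₂ p) = Sum.map inj₂ inj₂ (∈-++⁻ es p)
      from′ : ∀ {es′ a b} → Joins es a b ⊎ Joins es′ a b → Joins (es ++ es′) a b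
      from′ (inj₁ p) = Sum.map ∈-++⁺ˡ ∈-++⁺ˡ p
      from′ (inj₂ p) = Sum.map (∈-++⁺ʳ es) (∈-++⁺ʳ es) p

module _ {A : Set} where

  PathEdge-fromFocus : ∀ {f : A} {ls rs u} → f ∉ ls → f ∉ rs →
                       (u ≢ f × PathEdge f ls rs f u) ⇔ u ∈ List.take 1 ls ++ List.take 1 rs
  PathEdge-fromFocus {f} {ls} {rs} f∉ls f∉rs = mk⇔ to′ from′
    where
      to′ : ∀ {u} → u ≢ f × PathEdge f ls rs f u → u ∈ List.take 1 ls ++ List.take 1 rs
      to′ (_   , inj₁ (inj₁ now))       = here refl
      to′ (_   , inj₁ (inj₁ (later p))) = ⊥-elim (f∉ls (Consecutive⇒∈ˡ p))
      to′ (u≢f , inj₁ (inj₂ now))       = ⊥-elim (u≢f refl)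
      to′ (_   , inj₁ (inj₂ (later p))) = ⊥-elim (f∉ls (Consecutive⇒∈ʳ p))
      to′ (_   , inj₂ (inj₁ now))       = ∈-++⁺ʳ (List.take 1 ls) (here refl)
      to′ (_   , inj₂ (inj₁ (later p))) = ⊥-elim (f∉rs (Consecutive⇒∈ˡ p))
      to′ (u≢f , inj₂ (inj₂ now))       = ⊥-elim (u≢f refl)
      to′ (_   , inj₂ (inj₂ (later p))) = ⊥-elim (f∉rs (Consecutive⇒∈ʳ p))
      nearest : ∀ {xs u} → f ∉ xs → u ∈ List.take 1 xs → u ≢ f × Adjacent (f ∷ xs) f u
      nearest {_ ∷ _} f∉xs (here refl) = (λ u≡f → f∉xs (here (sym u≡f))) , inj₁ now
      from′ : ∀ {u} → u ∈ List.take 1 ls ++ List.take 1 rs → u ≢ f × PathEdge f ls rs f u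
      from′ p with ∈-++⁻ (List.take 1 ls) p
      ... | inj₁ p′ = Product.map₂ inj₁ (nearest f∉ls p′)
      ... | inj₂ p′ = Product.map₂ inj₂ (nearest f∉rs p′)

data Image {A B : Set} (g : A → B) (R : A → A → Set) : B → B → Set where
  image : ∀ {a b} → R a b → Image g R (g a) (g b)

module _ {A B : Set} {g : A → B} where

  Image-⇔ : ∀ {R S : A → A → Set} → (∀ {a b} → R a b ⇔ S a b) →
            ∀ {x y} → Image g R x y ⇔ Image g S x y
  Image-⇔ R⇔S = mk⇔ (λ { (image r) → image (to R⇔S r) }) (λ { (image s) → image (from R⇔S s) })

  Adjacent-map : ∀ xs {a b} → Adjacent (map g xs) a b ⇔ Image g (Adjacent xs) a b
  Adjacent-map xs = mk⇔ to′ from′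
    where
      to′ : ∀ {a b} → Adjacent (map g xs) a b → Image g (Adjacent xs) a b
      to′ (inj₁ p) with Consecutive-map⁻ g xs p
      ... | _ , _ , refl , refl , q = image (inj₁ q)
      to′ (inj₂ p) with Consecutive-map⁻ g xs p
      ... | _ , _ , refl , refl , q = image (inj₂ q)
      from′ : ∀ {a b} → Image g (Adjacent xs) a b → Adjacent (map g xs) a b
      from′ (image p) = Sum.map (Consecutive-map⁺ g) (Consecutive-map⁺ g) p

  Joins-map : ∀ es {a b} → Joins (map (Product.map g g) es) a b ⇔ Image g (Joins es) a b
  Joins-map es = mk⇔ to′ from′
    where
      to′ : ∀ {a b} → Joins (map (Product.map g g) es) a b → Image g (Joins es) a b
      to′ (inj₁ p) with ∈-map⁻ _ p
      ... | _ , e∈es , refl = image (inj₁ e∈es)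
      to′ (inj₂ p) with ∈-map⁻ _ p
      ... | _ , e∈es , refl = image (inj₂ e∈es)
      from′ : ∀ {a b} → Image g (Joins es) a b → Joins (map (Product.map g g) es) a b
      from′ (image p) = Sum.map (∈-map⁺ _) (∈-map⁺ _) p

record SimplePath {A : Set} (es : List (A × A)) (f : A) (ls rs : List A) : Set where
  field
    unique : Unique (f ∷ ls ++ rs)
    edges⇔ : ∀ {a b} → Joins es a b ⇔ PathEdge f ls rs a b

open SimplePath

module _ {A : Set} {es : List (A × A)} where

  focus∉ˡ : ∀ {f ls rs} → SimplePath es f ls rs → f ∉ ls
  focus∉ˡ P = Unique.Unique[x∷xs]⇒x∉xs (unique P) ∘ ∈-++⁺ˡ

  focus∉ʳ : ∀ {f ls rs} → SimplePath es f ls rs → f ∉ rs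
  focus∉ʳ {ls = ls} P = Unique.Unique[x∷xs]⇒x∉xs (unique P) ∘ ∈-++⁺ʳ ls

  SimplePath-swap : ∀ {f ls rs} → SimplePath es f ls rs → SimplePath es f rs ls
  SimplePath-swap {f} {ls} {rs} P = record
    { unique = Unique-swap f ls rs (unique P)
    ; edges⇔ = mk⇔ (PathEdge-swap ∘ to (edges⇔ P)) (from (edges⇔ P) ∘ PathEdge-swap)
    }

  SimplePath-moveLeft : ∀ {f l ls rs} → SimplePath es f (l ∷ ls) rs → SimplePath es l ls (f ∷ rs)
  SimplePath-moveLeft {f} {l} {ls} {rs} P = record
    { unique = to (Unique-shift f (l ∷ ls) rs) (unique P)
    ; edges⇔ = mk⇔ (PathEdge-moveLeft ∘ to (edges⇔ P)) (from (edges⇔ P) ∘ PathEdge-moveRight)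
    }

  SimplePath-moveRight : ∀ {f r ls rs} → SimplePath es f ls (r ∷ rs) → SimplePath es r (f ∷ ls) rs
  SimplePath-moveRight {f} {r} {ls} {rs} P = record
    { unique = from (Unique-shift r (f ∷ ls) rs) (unique P)
    ; edges⇔ = mk⇔ (PathEdge-moveRight ∘ to (edges⇔ P)) (from (edges⇔ P) ∘ PathEdge-moveLeft)
    }

module _ {n : ℕ} where

  liftEdge : Fin n × Fin n → Fin (suc n) × Fin (suc n)
  liftEdge = Product.map inject₁ inject₁

  extendEdges : List (Fin n × Fin n) → Fin n → List (Fin (suc n) × Fin (suc n))
  extendEdges es f = map liftEdge es ++ [ (fromℕ n , inject₁ f) ]

  SimplePath-extendʳ : ∀ {es f ls} → SimplePath es f ls [] →
                       SimplePath (extendEdges es f) (inject₁ f) (map inject₁ ls) [ fromℕ n ]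
  SimplePath-extendʳ {es} {f} {ls} P = record
    { unique = Unique.++⁺ (Unique.map⁺ inject₁-injective (subst (Unique ∘ (f ∷_)) (++-identityʳ ls) (unique P)))
                          ([] ∷ [])
                          (λ { (v∈old , here refl) → new∉old v∈old })
    ; edges⇔ = λ {a} {b} → begin
        Joins (extendEdges es f) a b
          ∼⟨ Joins-++ (map liftEdge es) ⟩
        (Joins (map liftEdge es) a b ⊎ Joins [ new-edge ] a b)
          ∼⟨ Joins-map es ⊎-⇔ ⇔-refl ⟩
        (Image inject₁ (Joins es) a b ⊎ Joins [ new-edge ] a b)
          ∼⟨ Image-⇔ (⇔-trans (edges⇔ P) PathEdge-[]ʳ) ⊎-⇔ ⇔-refl ⟩
        (Image inject₁ (Adjacent (f ∷ ls)) a b ⊎ Joins [ new-edge ] a b)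
          ∼⟨ ⇔-sym (Adjacent-map (f ∷ ls) ⊎-⇔ Adjacent-pair) ⟩
        PathEdge (inject₁ f) (map inject₁ ls) [ fromℕ n ] a b
          ∎
    }
    where
      open Related.EquationalReasoning {k = Related.equivalence}
      new-edge : Fin (suc n) × Fin (suc n)
      new-edge = fromℕ n , inject₁ f
      new∉old : ∀ {xs} → fromℕ n ∉ map inject₁ xs
      new∉old p with ∈-map⁻ inject₁ p
      ... | _ , _ , new≡old = fromℕ≢inject₁ new≡old

  SimplePath-extendˡ : ∀ {es f rs} → SimplePath es f [] rs →
                       SimplePath (extendEdges es f) (inject₁ f) [ fromℕ n ] (map inject₁ rs)
  SimplePath-extendˡ = SimplePath-swap ∘ SimplePath-extendʳ ∘ SimplePath-swap

chainEdges : ∀ m → List (Fin (suc m) × Fin (suc m))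
chainEdges m = map (λ i → inject₁ i , suc i) (allFin m)

SimplePath-chain : ∀ m → SimplePath (chainEdges m) zero [] (tabulate suc)
SimplePath-chain m = record
  { unique = Unique.allFin⁺ (suc m)
  ; edges⇔ = λ {a} {b} → begin
      Joins (chainEdges m) a b              ∼⟨ mk⇔ (Sum.map chainEdge⇒Consecutive chainEdge⇒Consecutive)
                                                   (Sum.map Consecutive⇒chainEdge Consecutive⇒chainEdge) ⟩
      Adjacent (allFin (suc m)) a b         ∼⟨ ⇔-sym PathEdge-[]ʳ ⟩
      PathEdge zero (tabulate suc) [] a b   ∼⟨ mk⇔ PathEdge-swap PathEdge-swap ⟩
      PathEdge zero [] (tabulate suc) a b   ∎
  }
  where
    open Related.EquationalReasoning {k = Related.equivalence}
    chainEdge⇒Consecutive : ∀ {a b} → (a , b) ∈ chainEdges m → Consecutive a b (allFin (suc m))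
    chainEdge⇒Consecutive p with ∈-map⁻ _ p
    ... | i , _ , refl = from (Consecutive-tabulate id) (i , refl , refl)
    Consecutive⇒chainEdge : ∀ {a b} → Consecutive a b (allFin (suc m)) → (a , b) ∈ chainEdges m
    Consecutive⇒chainEdge p with to (Consecutive-tabulate id) p
    ... | i , refl , refl = ∈-map⁺ _ (∈-allFin i)

module _ {A : Set} {_≺_ : A → A → Set} (≺-trans : Transitive _≺_) (≺-asym : Asymmetric _≺_) where

  private
    below : ∀ {x xs u} → Linked _≺_ (x ∷ xs) → u ∈ xs → x ≺ u
    below x∷xs↗ = All.lookup (AllPairs.head (Linked.Linked⇒AllPairs ≺-trans x∷xs↗))

    ≺-irrefl : ∀ {x y} → x ≡ y → ¬ x ≺ y
    ≺-irrefl refl x≺x = ≺-asym x≺x x≺x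

  Linked-≡ : ∀ {xs ys} → Linked _≺_ xs → Linked _≺_ ys →
             (∀ {u} → u ∈ xs ⇔ u ∈ ys) → xs ≡ ys
  Linked-≡ {[]}     {[]}     _   _   _     = refl
  Linked-≡ {[]}     {y ∷ _}  _   _   xs⇔ys with () ← from xs⇔ys (here refl)
  Linked-≡ {x ∷ _}  {[]}     _   _   xs⇔ys with () ← to xs⇔ys (here refl)
  Linked-≡ {x ∷ xs} {y ∷ ys} xs↗ ys↗ xs⇔ys with to xs⇔ys (here refl) | from xs⇔ys (here refl)
  ... | here refl  | _          =
    cong (x ∷_) (Linked-≡ (Linked.tail xs↗) (Linked.tail ys↗)
                          (mk⇔ (behind xs↗ (to xs⇔ys)) (behind ys↗ (from xs⇔ys))))
    where
      behind : ∀ {zs ws u} → Linked _≺_ (x ∷ zs) →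
               (u ∈ x ∷ zs → u ∈ x ∷ ws) → u ∈ zs → u ∈ ws
      behind zs↗ zs⊆ws u∈zs with zs⊆ws (there u∈zs)
      ... | here u≡x   = ⊥-elim (≺-irrefl (sym u≡x) (below zs↗ u∈zs))
      ... | there u∈ws = u∈ws
  ... | there x∈ys | here y≡x   = ⊥-elim (≺-irrefl y≡x (below ys↗ x∈ys))
  ... | there x∈ys | there y∈xs = ⊥-elim (≺-asym (below ys↗ x∈ys) (below xs↗ y∈xs))

allFin-↗ : ∀ n → Linked _<_ (allFin n)
allFin-↗ zero    = []
allFin-↗ (suc n) = Consecutive⇒Linked (allFin (suc n)) inject₁<suc
  where
    inject₁<suc : ∀ {a b} → Consecutive a b (allFin (suc n)) → a < b
    inject₁<suc p with to (Consecutive-tabulate id) p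
    ... | i , refl , refl = s≤s (ℕₚ.≤-reflexive (toℕ-inject₁ i))

-- Quest Graphs

module QuestGraphFacts (C nG nR : ℕ) where
  open QuestGraph C nG nR

  private
    T-≟ : ∀ {n} {x y : Fin n} → T ⌊ x ≟ y ⌋ ⇔ x ≡ y
    T-≟ = mk⇔ toWitness fromWitness

    T-not-≟ : ∀ {n} {x y : Fin n} → T (not ⌊ x ≟ y ⌋) ⇔ x ≢ y
    T-not-≟ {x = x} {y} with x ≟ y
    ... | yes x≡y = mk⇔ (λ ()) (λ x≢y → x≢y x≡y)
    ... | no  x≢y = mk⇔ (λ _ → x≢y) _

    Endpoints : ∀ {n} → Fin n → Fin n → Fin n × Fin n → Set
    Endpoints a b e = (proj₁ e ≡ a × proj₂ e ≡ b) ⊎ (proj₁ e ≡ b × proj₂ e ≡ a)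

    Endpoints⇔ : ∀ {n} {a b : Fin n} {e} → Endpoints a b e ⇔ ((a , b) ≡ e ⊎ (b , a) ≡ e)
    Endpoints⇔ = mk⇔ (λ { (inj₁ (refl , refl)) → inj₁ refl ; (inj₂ (refl , refl)) → inj₂ refl })
                     (λ { (inj₁ refl) → inj₁ (refl , refl) ; (inj₂ refl) → inj₂ (refl , refl) })

  T-adjB : ∀ {n} (es : List (Fin n × Fin n)) a b → T (adjB es a b) ⇔ Joins es a b
  T-adjB es a b = begin
    T (adjB es a b)                            ∼⟨ mk⇔ (any⁻ _ es) (any⁺ _) ⟩
    Any (T ∘ joins?) es                        ∼⟨ mk⇔ (Any.map (to T-joins?)) (Any.map (from T-joins?)) ⟩
    Any (λ e → (a , b) ≡ e ⊎ (b , a) ≡ e) es   ∼⟨ mk⇔ Any-⊎⁻ Any-⊎⁺ ⟩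
    Joins es a b                               ∎
    where
      open Related.EquationalReasoning {k = Related.equivalence}
      joins? : Fin _ × Fin _ → Bool
      joins? e = (⌊ proj₁ e ≟ a ⌋ ∧ ⌊ proj₂ e ≟ b ⌋) ∨
                 (⌊ proj₁ e ≟ b ⌋ ∧ ⌊ proj₂ e ≟ a ⌋)
      T-joins? : ∀ {e} → T (joins? e) ⇔ ((a , b) ≡ e ⊎ (b , a) ≡ e)
      T-joins? = ⇔-trans T-∨ (⇔-trans ((T-≟ ×-⇔ T-≟) ∘⇔ T-∧ ⊎-⇔ (T-≟ ×-⇔ T-≟) ∘⇔ T-∧)
                                      Endpoints⇔)

  Path-from : ∀ {n} (es : List (Fin n × Fin n)) xs →
              (∀ {x y} → Consecutive x y xs → Joins es x y) → Path es xs
  Path-from es []           joins = _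
  Path-from es (x ∷ [])     joins = _
  Path-from es (x ∷ y ∷ xs) joins =
    to T-≡ (from (T-adjB es x y) (joins now)) , Path-from es (y ∷ xs) (joins ∘ later)

  neighbours-∈ : ∀ q {ls rs} → SimplePath (QG.edges q) (QG.focus q) ls rs →
                 ∀ {u} → u ∈ neighbours q ⇔ u ∈ List.take 1 ls ++ List.take 1 rs
  neighbours-∈ q {ls} {rs} P {u} = begin
    u ∈ neighbours q
      ∼⟨ mk⇔ (proj₂ ∘ ∈-filter⁻ (T? ∘ isNeighbour) {xs = allFin n})
             (∈-filter⁺ (T? ∘ isNeighbour) (∈-allFin u)) ⟩
    T (isNeighbour u)
      ∼⟨ T-∧ ⟩
    (T (not ⌊ u ≟ focus ⌋) × T (adjB edges focus u))
      ∼⟨ T-not-≟ ×-⇔ ⇔-trans (T-adjB edges focus u) (edges⇔ P) ⟩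
    (u ≢ focus × PathEdge focus ls rs focus u)
      ∼⟨ PathEdge-fromFocus (focus∉ˡ P) (focus∉ʳ P) ⟩
    u ∈ List.take 1 ls ++ List.take 1 rs
      ∎
    where
      open QG q
      open Related.EquationalReasoning {k = Related.equivalence}
      isNeighbour : Fin n → Bool
      isNeighbour u = not ⌊ u ≟ focus ⌋ ∧ adjB edges focus u

  neighbours-≡ : ∀ q {ls rs xs} → SimplePath (QG.edges q) (QG.focus q) ls rs → Linked _<_ xs →
                 (∀ {u} → u ∈ xs ⇔ u ∈ List.take 1 ls ++ List.take 1 rs) → neighbours q ≡ xs
  neighbours-≡ q P xs↗ xs⇔ =
    Linked-≡ <-trans <-asym (Linked.filter⁺ _ <-trans (allFin-↗ _)) xs↗
             (⇔-trans (neighbours-∈ q P) (⇔-sym xs⇔))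

  run-+ : ∀ χ q t j → run χ q (j + t) ≡ (run χ q t >>= λ q′ → run χ q′ j)
  run-+ χ q t zero with run χ q t
  ... | nothing = refl
  ... | just _  = refl
  run-+ χ q t (suc j) rewrite run-+ χ q t j with run χ q t
  ... | nothing = refl
  ... | just _  = refl

  run-suc : ∀ χ q j → run χ q (suc j) ≡ (step χ q >>= λ q′ → run χ q′ j)
  run-suc χ q zero with step χ q
  ... | nothing = refl
  ... | just _  = refl
  run-suc χ q (suc j) rewrite run-suc χ q j with step χ q
  ... | nothing = refl
  ... | just _  = refl

  run-step : ∀ χ {q q′} j → step χ q ≡ just q′ → run χ q (suc j) ≡ run χ q′ j
  run-step χ {q} j stepped = trans (run-suc χ q j) (cong (_>>= λ q′ → run χ q′ j) stepped)

  run-+-just : ∀ χ {q q′ t} j → run χ q t ≡ just q′ → run χ q (j + t) ≡ run χ q′ j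
  run-+-just χ {q} {t = t} j ran = trans (run-+ χ q t j) (cong (_>>= λ q′ → run χ q′ j) ran)

  run-after : ∀ χ q t {q′} j → run χ q t ≡ just q′ → run χ q j ≡ nothing →
              ∃ λ j′ → j ≡ j′ + t × run χ q′ j′ ≡ nothing
  run-after χ q t j ran stopped with t ℕₚ.≤? j
  ... | yes t≤j = j ∸ t , sym (ℕₚ.m∸n+n≡m t≤j) ,
                  trans (sym (run-+-just χ (j ∸ t) ran))
                        (trans (cong (run χ q) (ℕₚ.m∸n+n≡m t≤j)) stopped)
  ... | no t≰j with () ← trans (sym ran)
                           (trans (cong (run χ q) (sym (ℕₚ.m∸n+n≡m (ℕₚ.≰⇒≥ t≰j))))
                                  (trans (run-+ χ q j (t ∸ j)) (cong (_>>= λ q′ → run χ q′ (t ∸ j)) stopped)))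

-- The agent

_⊕_ : ∀ {m n} {A B : Set} → Fin m ↔ A → Fin n ↔ B → Fin (m + n) ↔ (A ⊎ B)
e₁ ⊕ e₂ = (e₁ ⊎-↔ e₂) ↔-∘ +↔⊎

_⊗_ : ∀ {m n} {A B : Set} → Fin m ↔ A → Fin n ↔ B → Fin (m * n) ↔ (A × B)
e₁ ⊗ e₂ = (e₁ ×-↔ e₂) ↔-∘ *↔×

infixr 4 _⊕_
infixr 5 _⊗_

Fin2↔Move : Fin 2 ↔ Move
Fin2↔Move = mk↔ₛ′ (λ { zero → L ; (suc _) → R }) (λ { L → zero ; R → suc zero })
                  (λ { L → refl ; R → refl }) (λ { zero → refl ; (suc zero) → refl })

module Construction (M : TM) where
  open TM M
  open TMSemantics M
  open Config using (state; left; head; right)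

  Transition : Set
  Transition = Fin nS × Fin nΓ × Move

  -- passive a: a cell holding a;  fresh: a newly discovered blank cell;
  -- active s a: the head, in state s, over a;  marked s b d: the head, having chosen to
  -- write b, move d and enter s;  trail s b d: the old head, handing s over to its d-side.
  data Resp : Set where
    passive : Fin nΓ → Resp
    fresh   : Resp
    active  : Fin nS → Fin nΓ → Resp
    marked  : Fin nS → Fin nΓ → Move → Resp
    trail   : Fin nS → Fin nΓ → Move → Resp

  Resp↔ : (Fin nΓ ⊎ ⊤ ⊎ (Fin nS × Fin nΓ) ⊎ Transition ⊎ Transition) ↔ Resp
  Resp↔ = mk↔ₛ′ fromSum toSum fromSum∘toSum toSum∘fromSum
    where
      fromSum : Fin nΓ ⊎ ⊤ ⊎ (Fin nS × Fin nΓ) ⊎ Transition ⊎ Transition → Resp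
      fromSum (inj₁ a)                                = passive a
      fromSum (inj₂ (inj₁ _))                         = fresh
      fromSum (inj₂ (inj₂ (inj₁ (s , a))))            = active s a
      fromSum (inj₂ (inj₂ (inj₂ (inj₁ (s , b , d))))) = marked s b d
      fromSum (inj₂ (inj₂ (inj₂ (inj₂ (s , b , d))))) = trail s b d
      toSum : Resp → Fin nΓ ⊎ ⊤ ⊎ (Fin nS × Fin nΓ) ⊎ Transition ⊎ Transition
      toSum (passive a)    = inj₁ a
      toSum fresh          = inj₂ (inj₁ tt)
      toSum (active s a)   = inj₂ (inj₂ (inj₁ (s , a)))
      toSum (marked s b d) = inj₂ (inj₂ (inj₂ (inj₁ (s , b , d))))
      toSum (trail s b d)  = inj₂ (inj₂ (inj₂ (inj₂ (s , b , d))))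
      fromSum∘toSum : ∀ r → fromSum (toSum r) ≡ r
      fromSum∘toSum (passive a)    = refl
      fromSum∘toSum fresh          = refl
      fromSum∘toSum (active s a)   = refl
      fromSum∘toSum (marked s b d) = refl
      fromSum∘toSum (trail s b d)  = refl
      toSum∘fromSum : ∀ x → toSum (fromSum x) ≡ x
      toSum∘fromSum (inj₁ _)                         = refl
      toSum∘fromSum (inj₂ (inj₁ _))                  = refl
      toSum∘fromSum (inj₂ (inj₂ (inj₁ _)))           = refl
      toSum∘fromSum (inj₂ (inj₂ (inj₂ (inj₁ _))))    = refl
      toSum∘fromSum (inj₂ (inj₂ (inj₂ (inj₂ _))))    = refl

  nR : ℕ
  nR = nΓ + (1 + (nS * nΓ + (nS * (nΓ * 2) + nS * (nΓ * 2))))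

  Fin↔Resp : Fin nR ↔ Resp
  Fin↔Resp = Resp↔ ↔-∘ (↔-id _ ⊕ 1↔⊤ ⊕ ↔-id _ ⊗ ↔-id _ ⊕ transition ⊕ transition)
    where
      transition : Fin (nS * (nΓ * 2)) ↔ Transition
      transition = ↔-id _ ⊗ ↔-id _ ⊗ Fin2↔Move

  encode : Resp → Fin nR
  encode = Inverse.from Fin↔Resp

  decode : Fin nR → Resp
  decode = Inverse.to Fin↔Resp

  decode-encode : ∀ r → decode (encode r) ≡ r
  decode-encode = Inverse.strictlyInverseˡ Fin↔Resp

  open QuestGraph 2 3 nR
  open QuestGraphFacts 2 3 nR

  Goal : Set
  Goal = Fin 3

  pattern inChain  = zero
  pattern leftExt  = suc zero
  pattern rightExt = suc (suc zero)

  -- Neighbours are listed in order of creation.  Cells left of the initial chain are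
  -- created right to left, all others left to right, so goals tell left from right.
  -- A context shows at most C = 2 neighbours.
  sides : Goal → ∀ {k} → Vec Goal k → Maybe (Fin k) × Maybe (Fin k)
  sides _        []                 = nothing , nothing
  sides leftExt  (_ ∷ [])           = nothing , just zero
  sides _        (_ ∷ [])           = just zero , nothing
  sides leftExt  (_ ∷ _ ∷ [])       = just (suc zero) , just zero
  sides inChain  (_ ∷ leftExt ∷ []) = just (suc zero) , just zero
  sides _        (_ ∷ _ ∷ [])       = just zero , just (suc zero)
  sides _        (_ ∷ _ ∷ _ ∷ _)    = nothing , nothing

  View : Set
  View = Maybe (Goal × Resp)

  data Target : Set where
    stay toLeft toRight : Target

  data Decision : Set where
    halt   : Decision
    write  : Resp → Target → Decision
    extend : Goal → Resp → Decision

  towards : Move → Target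
  towards L = toLeft
  towards R = toRight

  extensionGoal : Move → Goal
  extensionGoal L = leftExt
  extensionGoal R = rightExt

  on : Move → View → View → View
  on L lv rv = lv
  on R lv rv = rv

  trailState : View → Maybe (Fin nS)
  trailState (just (_ , trail s _ _)) = just s
  trailState _                        = nothing

  isLeftExt : View → Bool
  isLeftExt (just (leftExt , _)) = true
  isLeftExt _                    = false

  -- The last two cases start the simulation on the initial chain: first a blank cell
  -- is discovered left of the chain, then the head is placed.
  enter : Fin nΓ → Maybe (Fin nS) → Maybe (Fin nS) → Bool → Decision
  enter a (just s) _        _     = write (active s a) toLeft
  enter a nothing  (just s) _     = write (active s a) toRight
  enter a nothing  nothing  true  = write (active s₀ a) stay
  enter a nothing  nothing  false = extend leftExt (passive blank)

  enterCell : Fin nΓ → View → View → Decision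
  enterCell a lv rv = enter a (trailState lv) (trailState rv) (isLeftExt lv ∨ isLeftExt rv)

  -- Marking an existing target cell costs one agent step, as discovering a missing
  -- one does, so that every step of M takes exactly four agent steps.
  moveTo : Fin nS → Fin nΓ → Move → View → Decision
  moveTo s b d nothing            = extend (extensionGoal d) fresh
  moveTo s b d (just (_ , fresh)) = write (trail s b d) (towards d)
  moveTo s b d (just _)           = write (marked s b d) stay

  perform-δ : Fin nS → Fin nΓ → Maybe Transition → View → View → Decision
  perform-δ s a nothing             lv rv = write (active s a) stay
  perform-δ s a (just (s′ , b , d)) lv rv = moveTo s′ b d (on d lv rv)

  decide : Resp → View → View → Decision
  decide (passive a)    lv rv = enterCell a lv rv
  decide fresh          lv rv = enterCell blank lv rv
  decide (active s a)   lv rv = if accepting s then halt else perform-δ s a (δ s a) lv rv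
  decide (marked s b d) _  _  = write (trail s b d) (towards d)
  decide (trail s b d)  _  _  = write (passive b) (towards d)

  realise : ∀ {k} → Maybe (Fin k) → Maybe (Fin k) → Decision → Action k
  realise pl pr halt              = stop
  realise pl pr (extend g r)      = discover (g , encode r) (nothing ∷ []) (s≤s z≤n)
  realise pl pr (write r stay)    = respond (encode r) nothing
  realise pl pr (write r toLeft)  = respond (encode r) pl
  realise pl pr (write r toRight) = respond (encode r) pr

  viewOf : 𝒱 → Goal × Resp
  viewOf (g , r) = g , decode r

  sidesOf : ∀ {k} → 𝒱 → Vec 𝒱 k → Maybe (Fin k) × Maybe (Fin k)
  sidesOf v vs = sides (proj₁ v) (Vec.map proj₁ vs)

  χ : Agent
  χ c = realise pl pr (decide (decode (proj₂ (Ctx.here c))) (look pl) (look pr))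
    where
      open Ctx c using (k; nbrs)
      pl pr : Maybe (Fin k)
      pl = proj₁ (sidesOf (Ctx.here c) nbrs)
      pr = proj₂ (sidesOf (Ctx.here c) nbrs)
      look : Maybe (Fin k) → View
      look = Maybe.map (viewOf ∘ Vec.lookup nbrs)

  symbolOf : Resp → Fin nΓ
  symbolOf (passive a)    = a
  symbolOf fresh          = blank
  symbolOf (active _ a)   = a
  symbolOf (marked _ b _) = b
  symbolOf (trail _ b _)  = b

  stateOf : Resp → Fin nS
  stateOf (active s _) = s
  stateOf _            = s₀

  symOf : 𝒱 → Fin nΓ
  symOf = symbolOf ∘ decode ∘ proj₂

  stOf : 𝒱 → Fin nS
  stOf = stateOf ∘ decode ∘ proj₂

  initCfg : Fin nΓ → 𝒱
  initCfg a = inChain , encode (passive a)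

  -- what QuestGraph.apply does for respond and for discover attached to the focus
  overwrite : (q : QG) → Fin nR → Fin (QG.n q) → QG
  overwrite q r z = record
    { n     = QG.n q
    ; cfg   = λ u → if ⌊ u ≟ QG.focus q ⌋ then (proj₁ (QG.cfg q u) , r) else QG.cfg q u
    ; edges = QG.edges q
    ; focus = z
    }

  attach : QG → 𝒱 → QG
  attach q v = record
    { n     = suc (QG.n q)
    ; cfg   = snocF (QG.cfg q) v
    ; edges = extendEdges (QG.edges q) (QG.focus q)
    ; focus = inject₁ (QG.focus q)
    }

  target : ∀ {n} → Fin n → Maybe (Fin n) → Maybe (Fin n) → Target → Fin n
  target f l r stay    = f
  target f l r toLeft  = Maybe.fromMaybe f l
  target f l r toRight = Maybe.fromMaybe f r

  perform : (q : QG) → Maybe (Fin (QG.n q)) → Maybe (Fin (QG.n q)) → Decision → Maybe QG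
  perform q l r halt         = nothing
  perform q l r (write x t)  = just (overwrite q (encode x) (target (QG.focus q) l r t))
  perform q l r (extend g x) = just (attach q (g , encode x))

  respAt : (q : QG) → Fin (QG.n q) → Resp
  respAt q u = decode (proj₂ (QG.cfg q u))

  viewAt : (q : QG) → Maybe (Fin (QG.n q)) → View
  viewAt q = Maybe.map (viewOf ∘ QG.cfg q)

  lookupBoth : ∀ {A : Set} (xs : List A) →
               Maybe (Fin (List.length xs)) × Maybe (Fin (List.length xs)) → Maybe A × Maybe A
  lookupBoth xs = Product.map (Maybe.map (List.lookup xs)) (Maybe.map (List.lookup xs))

  sideNodesAmong : (q : QG) (xs : List (Fin (QG.n q))) → Maybe (Fin (QG.n q)) × Maybe (Fin (QG.n q))
  sideNodesAmong q xs = lookupBoth xs (sidesOf (QG.cfg q (QG.focus q)) (Vec.map (QG.cfg q) (Vec.fromList xs)))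

  sideNodes : (q : QG) → Maybe (Fin (QG.n q)) × Maybe (Fin (QG.n q))
  sideNodes q = sideNodesAmong q (ctxIds q)

  decideAt : (q : QG) → Maybe (Fin (QG.n q)) × Maybe (Fin (QG.n q)) → Decision
  decideAt q (l , r) = decide (respAt q (QG.focus q)) (viewAt q l) (viewAt q r)

  step-χ : ∀ q →
           step χ q ≡ perform q (proj₁ (sideNodes q)) (proj₂ (sideNodes q)) (decideAt q (sideNodes q))
  step-χ q = trans (realise-perform pl pr _)
                   (cong (perform q _ _) (cong₂ (decide (respAt q (QG.focus q))) (look-viewAt pl) (look-viewAt pr)))
    where
      open QG q
      ids : List (Fin n)
      ids = ctxIds q
      pl pr : Maybe (Fin (List.length ids))
      pl = proj₁ (sidesOf (cfg focus) (Vec.map cfg (Vec.fromList ids)))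
      pr = proj₂ (sidesOf (cfg focus) (Vec.map cfg (Vec.fromList ids)))

      realise-perform : ∀ l r d → apply q (realise l r d) ≡
                                  perform q (Maybe.map (List.lookup ids) l) (Maybe.map (List.lookup ids) r) d
      realise-perform l        r        halt              = refl
      realise-perform l        r        (extend g x)      = refl
      realise-perform l        r        (write x stay)    = refl
      realise-perform nothing  r        (write x toLeft)  = refl
      realise-perform (just i) r        (write x toLeft)  = refl
      realise-perform l        nothing  (write x toRight) = refl
      realise-perform l        (just i) (write x toRight) = refl

      look-viewAt : ∀ p → Maybe.map (viewOf ∘ Vec.lookup (Vec.map cfg (Vec.fromList ids))) p ≡
                          viewAt q (Maybe.map (List.lookup ids) p)
      look-viewAt nothing  = refl
      look-viewAt (just i) =
        cong (just ∘ viewOf) (trans (Vec.lookup-map i cfg (Vec.fromList ids)) (cong cfg (lookup-fromList ids i)))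

  -- The invariant

  data GoalStep : Goal → Goal → Set where
    left-left   : GoalStep leftExt leftExt
    left-chain  : GoalStep leftExt inChain
    chain-chain : GoalStep inChain inChain
    chain-right : GoalStep inChain rightExt
    right-right : GoalStep rightExt rightExt

  CreatedInOrder : Goal → ∀ {n} → Fin n → Fin n → Set
  CreatedInOrder leftExt x y = y < x
  CreatedInOrder _       x y = x < y

  -- x is the left neighbour of y
  WellPlaced : ∀ {n} → (Fin n → Goal) → Fin n → Fin n → Set
  WellPlaced G x y = GoalStep (G x) (G y) × CreatedInOrder (G x) x y

  record Layout {n} (es : List (Fin n × Fin n)) (G : Fin n → Goal) (f : Fin n) (ls rs : List (Fin n)) : Set where
    field
      path     : SimplePath es f ls rs
      placedˡ  : Linked (flip (WellPlaced G)) (f ∷ ls)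
      placedʳ  : Linked (WellPlaced G) (f ∷ rs)
      rightEnd : G (lastOr f rs) ≢ leftExt

  open Layout

  WellPlaced-map : ∀ {n n′} {G : Fin n → Goal} {G′ : Fin n′ → Goal} (h : Fin n → Fin n′) →
                   (∀ {x y} → x < y → h x < h y) → (∀ u → G′ (h u) ≡ G u) →
                   ∀ {x y} → WellPlaced G x y → WellPlaced G′ (h x) (h y)
  WellPlaced-map {G = G} h h-mono G′∘h {x} {y} (step , order)
    rewrite G′∘h x | G′∘h y = step , mono (G x) order
    where
      mono : ∀ g → CreatedInOrder g x y → CreatedInOrder g (h x) (h y)
      mono inChain  = h-mono
      mono leftExt  = h-mono
      mono rightExt = h-mono

  inject₁-mono : ∀ {n} {x y : Fin n} → x < y → inject₁ x < inject₁ y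
  inject₁-mono {x = x} {y} x<y rewrite toℕ-inject₁ x | toℕ-inject₁ y = x<y

  inject₁<fromℕ : ∀ {n} (x : Fin n) → inject₁ x < fromℕ n
  inject₁<fromℕ {n} x rewrite toℕ-inject₁ x | toℕ-fromℕ n = toℕ<n x

  Layout-cong : ∀ {n es G G′} {f : Fin n} {ls rs} → (∀ u → G′ u ≡ G u) →
                Layout es G f ls rs → Layout es G′ f ls rs
  Layout-cong {f = f} {rs = rs} G′≗G Λ = record
    { path     = path Λ
    ; placedˡ  = Linked.map (WellPlaced-map id id G′≗G) (placedˡ Λ)
    ; placedʳ  = Linked.map (WellPlaced-map id id G′≗G) (placedʳ Λ)
    ; rightEnd = rightEnd Λ ∘ trans (sym (G′≗G (lastOr f rs)))
    }

  Layout-moveLeft : ∀ {n es G} {f l : Fin n} {ls rs} →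
                    Layout es G f (l ∷ ls) rs → Layout es G l ls (f ∷ rs)
  Layout-moveLeft Λ = record
    { path     = SimplePath-moveLeft (path Λ)
    ; placedˡ  = Linked.tail (placedˡ Λ)
    ; placedʳ  = Linked.head (placedˡ Λ) ∷ placedʳ Λ
    ; rightEnd = rightEnd Λ
    }

  Layout-moveRight : ∀ {n es G} {f r : Fin n} {ls rs} →
                     Layout es G f ls (r ∷ rs) → Layout es G r (f ∷ ls) rs
  Layout-moveRight Λ = record
    { path     = SimplePath-moveRight (path Λ)
    ; placedˡ  = Linked.head (placedʳ Λ) ∷ placedˡ Λ
    ; placedʳ  = Linked.tail (placedʳ Λ)
    ; rightEnd = rightEnd Λ
    }

  module _ {n} {es : List (Fin n × Fin n)} {G : Fin n → Goal} {G′ : Fin (suc n) → Goal}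
           (G′∘inject₁ : ∀ u → G′ (inject₁ u) ≡ G u) where

    private
      lift : ∀ {x y} → WellPlaced G x y → WellPlaced G′ (inject₁ x) (inject₁ y)
      lift = WellPlaced-map {G′ = G′} inject₁ inject₁-mono G′∘inject₁

    Layout-extendʳ : ∀ {f ls} → G′ (fromℕ n) ≡ rightExt → Layout es G f ls [] →
                     Layout (extendEdges es f) G′ (inject₁ f) (map inject₁ ls) [ fromℕ n ]
    Layout-extendʳ {f} G′new Λ = record
      { path     = SimplePath-extendʳ (path Λ)
      ; placedˡ  = Linked.map⁺ (Linked.map lift (placedˡ Λ))
      ; placedʳ  = subst₂ (λ g g′ → GoalStep g g′ × CreatedInOrder g (inject₁ f) (fromℕ n))
                          (sym (G′∘inject₁ f)) (sym G′new) (leftOfNew (G f) (rightEnd Λ)) ∷ [-]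
      ; rightEnd = λ G′new≡leftExt → case trans (sym G′new) G′new≡leftExt of λ ()
      }
      where
        leftOfNew : ∀ g → g ≢ leftExt → GoalStep g rightExt × CreatedInOrder g (inject₁ f) (fromℕ n)
        leftOfNew inChain  _         = chain-right , inject₁<fromℕ f
        leftOfNew leftExt  g≢leftExt = ⊥-elim (g≢leftExt refl)
        leftOfNew rightExt _         = right-right , inject₁<fromℕ f

    Layout-extendˡ : ∀ {f rs} → G′ (fromℕ n) ≡ leftExt → GoalStep leftExt (G f) →
                     Layout es G f [] rs → Layout (extendEdges es f) G′ (inject₁ f) [ fromℕ n ] (map inject₁ rs)
    Layout-extendˡ {f} {rs} G′new step Λ = record
      { path     = SimplePath-extendˡ (path Λ)
      ; placedˡ  = subst₂ (λ g g′ → GoalStep g g′ × CreatedInOrder g (fromℕ n) (inject₁ f))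
                          (sym G′new) (sym (G′∘inject₁ f)) (step , inject₁<fromℕ f) ∷ [-]
      ; placedʳ  = Linked.map⁺ (Linked.map lift (placedʳ Λ))
      ; rightEnd = rightEnd Λ ∘ trans (sym (trans (cong G′ (lastOr-map inject₁ f rs)) (G′∘inject₁ _)))
      }

  Layout-chain : ∀ m → Layout (chainEdges m) (λ _ → inChain) zero [] (tabulate suc)
  Layout-chain m = record
    { path     = SimplePath-chain m
    ; placedˡ  = [-]
    ; placedʳ  = Linked.map (chain-chain ,_) (allFin-↗ (suc m))
    ; rightEnd = λ ()
    }

  goalAt : (q : QG) → Fin (QG.n q) → Goal
  goalAt q u = proj₁ (QG.cfg q u)

  record Shape (q : QG) (ls rs : List (Fin (QG.n q))) : Set where
    field
      layout  : Layout (QG.edges q) (goalAt q) (QG.focus q) ls rs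
      leftEnd : goalAt q (lastOr (QG.focus q) ls) ≡ leftExt

  open Shape

  module _ (q : QG) (r : Fin nR) (z : Fin (QG.n q)) where
    open QG q

    overwrite-focus : QG.cfg (overwrite q r z) focus ≡ (goalAt q focus , r)
    overwrite-focus with focus ≟ focus
    ... | yes _   = refl
    ... | no  f≢f = ⊥-elim (f≢f refl)

    overwrite-other : ∀ {u} → u ≢ focus → QG.cfg (overwrite q r z) u ≡ cfg u
    overwrite-other {u} u≢f with u ≟ focus
    ... | yes u≡f = ⊥-elim (u≢f u≡f)
    ... | no  _   = refl

    overwrite-goal : ∀ u → goalAt (overwrite q r z) u ≡ goalAt q u
    overwrite-goal u with u ≟ focus
    ... | yes _ = refl
    ... | no  _ = refl

    Shape-overwrite : ∀ {ls rs} → Layout edges (goalAt q) z ls rs → goalAt q (lastOr z ls) ≡ leftExt →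
                      Shape (overwrite q r z) ls rs
    Shape-overwrite {ls} Λ end = record
      { layout  = Layout-cong overwrite-goal Λ
      ; leftEnd = trans (overwrite-goal (lastOr z ls)) end
      }

  respAt-overwrite : ∀ q x z → respAt (overwrite q (encode x) z) (QG.focus q) ≡ x
  respAt-overwrite q x z = trans (cong (decode ∘ proj₂) (overwrite-focus q (encode x) z)) (decode-encode x)

  Shape-stay : ∀ {q ls rs} r → Shape q ls rs → Shape (overwrite q r (QG.focus q)) ls rs
  Shape-stay {q} r S = Shape-overwrite q r _ (layout S) (leftEnd S)

  Shape-moveLeft : ∀ {q l ls rs} r → Shape q (l ∷ ls) rs → Shape (overwrite q r l) ls (QG.focus q ∷ rs)
  Shape-moveLeft {q} r S = Shape-overwrite q r _ (Layout-moveLeft (layout S)) (leftEnd S)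

  Shape-moveRight : ∀ {q ls r rs} x → Shape q ls (r ∷ rs) → Shape (overwrite q x r) (QG.focus q ∷ ls) rs
  Shape-moveRight {q} x S = Shape-overwrite q x _ (Layout-moveRight (layout S)) (leftEnd S)

  snocF-inject₁ : ∀ {n} (f : Fin n → 𝒱) v u → snocF f v (inject₁ u) ≡ f u
  snocF-inject₁ {suc n} f v zero    = refl
  snocF-inject₁ {suc n} f v (suc u) = snocF-inject₁ (f ∘ suc) v u

  snocF-fromℕ : ∀ {n} (f : Fin n → 𝒱) v → snocF f v (fromℕ n) ≡ v
  snocF-fromℕ {zero}  f v = refl
  snocF-fromℕ {suc n} f v = snocF-fromℕ (f ∘ suc) v

  module _ (q : QG) (v : 𝒱) where
    open QG q

    attach-old : ∀ u → QG.cfg (attach q v) (inject₁ u) ≡ cfg u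
    attach-old = snocF-inject₁ cfg v

    attach-new : QG.cfg (attach q v) (fromℕ n) ≡ v
    attach-new = snocF-fromℕ cfg v

    private
      goal-old : ∀ u → goalAt (attach q v) (inject₁ u) ≡ goalAt q u
      goal-old = cong proj₁ ∘ attach-old

    Shape-extendʳ : ∀ {ls} → proj₁ v ≡ rightExt → Shape q ls [] →
                    Shape (attach q v) (map inject₁ ls) [ fromℕ n ]
    Shape-extendʳ {ls} v-right S = record
      { layout  = Layout-extendʳ goal-old (trans (cong proj₁ attach-new) v-right) (layout S)
      ; leftEnd = trans (cong (goalAt (attach q v)) (lastOr-map inject₁ focus ls)) (trans (goal-old _) (leftEnd S))
      }

    Shape-extendˡ : ∀ {rs} → proj₁ v ≡ leftExt → GoalStep leftExt (goalAt q focus) →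
                    Layout edges (goalAt q) focus [] rs → Shape (attach q v) [ fromℕ n ] (map inject₁ rs)
    Shape-extendˡ v-left step Λ = record
      { layout  = Layout-extendˡ goal-old new-left step Λ
      ; leftEnd = new-left
      }
      where
        new-left : goalAt (attach q v) (fromℕ n) ≡ leftExt
        new-left = trans (cong proj₁ attach-new) v-left

  sides-single : ∀ g {x} → g ≢ leftExt → sides g (x ∷ []) ≡ (just zero , nothing)
  sides-single inChain  _         = refl
  sides-single leftExt  g≢leftExt = ⊥-elim (g≢leftExt refl)
  sides-single rightExt _         = refl

  sides-pair : ∀ {n} {f l r : Fin n} {gf gl gr} →
               GoalStep gl gf → CreatedInOrder gl l f → GoalStep gf gr → CreatedInOrder gf f r → l ≢ r →
               (l < r × sides gf (gl ∷ gr ∷ []) ≡ (just zero , just (suc zero))) ⊎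
               (r < l × sides gf (gr ∷ gl ∷ []) ≡ (just (suc zero) , just zero))
  sides-pair left-left   f<l left-left   r<f _ = inj₂ (<-trans r<f f<l , refl)
  sides-pair left-left   f<l left-chain  r<f _ = inj₂ (<-trans r<f f<l , refl)
  sides-pair chain-chain l<f chain-chain f<r _ = inj₁ (<-trans l<f f<r , refl)
  sides-pair chain-chain l<f chain-right f<r _ = inj₁ (<-trans l<f f<r , refl)
  sides-pair chain-right l<f right-right f<r _ = inj₁ (<-trans l<f f<r , refl)
  sides-pair right-right l<f right-right f<r _ = inj₁ (<-trans l<f f<r , refl)
  sides-pair {l = l} {r} left-chain _ step _ l≢r with <-cmp l r | step
  ... | tri< l<r _ _ | chain-chain = inj₁ (l<r , refl)
  ... | tri< l<r _ _ | chain-right = inj₁ (l<r , refl)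
  ... | tri≈ _ l≡r _ | _           = ⊥-elim (l≢r l≡r)
  ... | tri> _ _ r<l | chain-chain = inj₂ (r<l , refl)
  ... | tri> _ _ r<l | chain-right = inj₂ (r<l , refl)

  sideNodes-shape : ∀ {q ls rs} → Shape q ls rs → sideNodes q ≡ (List.head ls , List.head rs)
  sideNodes-shape {q} {[]} {[]} S = ⊥-elim (rightEnd (layout S) (leftEnd S))
  sideNodes-shape {q} {[]} {r ∷ _} S =
    trans (cong (sideNodesAmong q ∘ List.take 2) (neighbours-≡ q (path (layout S)) [-] ⇔-refl))
          (cong (λ g → lookupBoth (r ∷ []) (sides g (goalAt q r ∷ []))) (leftEnd S))
  sideNodes-shape {q} {l ∷ _} {[]} S =
    trans (cong (sideNodesAmong q ∘ List.take 2) (neighbours-≡ q (path (layout S)) [-] ⇔-refl))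
          (cong (lookupBoth (l ∷ [])) (sides-single _ (rightEnd (layout S))))
  sideNodes-shape {q} {l ∷ ls} {r ∷ rs} S
    with sides-pair (proj₁ (Linked.head (placedˡ Λ))) (proj₂ (Linked.head (placedˡ Λ)))
                    (proj₁ (Linked.head (placedʳ Λ))) (proj₂ (Linked.head (placedʳ Λ))) l≢r
    where
      Λ : Layout (QG.edges q) (goalAt q) (QG.focus q) (l ∷ ls) (r ∷ rs)
      Λ = layout S
      l≢r : l ≢ r
      l≢r refl = Unique.Unique[x∷xs]⇒x∉xs (AllPairs.tail (unique (path Λ))) (∈-++⁺ʳ ls (here refl))
  ... | inj₁ (l<r , sides≡) =
    trans (cong (sideNodesAmong q ∘ List.take 2) (neighbours-≡ q (path (layout S)) (l<r ∷ [-]) ⇔-refl))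
          (cong (lookupBoth (l ∷ r ∷ [])) sides≡)
  ... | inj₂ (r<l , sides≡) =
    trans (cong (sideNodesAmong q ∘ List.take 2) (neighbours-≡ q (path (layout S)) (r<l ∷ [-]) ∈-swap))
          (cong (lookupBoth (r ∷ l ∷ [])) sides≡)
    where
      ∈-swap : ∀ {u} → u ∈ r ∷ l ∷ [] ⇔ u ∈ l ∷ r ∷ []
      ∈-swap = mk⇔ (Any-resp-↭ (↭-swap r l ↭-refl)) (Any-resp-↭ (↭-swap l r ↭-refl))

  step-shape : ∀ {q ls rs} → Shape q ls rs →
               step χ q ≡ perform q (List.head ls) (List.head rs) (decideAt q (List.head ls , List.head rs))
  step-shape {q} S =
    trans (step-χ q) (cong (λ p → perform q (proj₁ p) (proj₂ p) (decideAt q p)) (sideNodes-shape S))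

  step-by : ∀ {q ls rs} d → Shape q ls rs → decideAt q (List.head ls , List.head rs) ≡ d →
            step χ q ≡ perform q (List.head ls) (List.head rs) d
  step-by d S decided = trans (step-shape S) (cong (perform _ _ _) decided)

  IsPassive : (q : QG) → Fin (QG.n q) → Set
  IsPassive q u = ∃ λ a → respAt q u ≡ passive a

  symbolAt : (q : QG) → Fin (QG.n q) → Fin nΓ
  symbolAt q u = symOf (QG.cfg q u)

  record Shows (q : QG) (us : List (Fin (QG.n q))) (t : List (Fin nΓ)) : Set where
    constructor shows
    field
      passives : All (IsPassive q) us
      tape     : TapeEq blank (map (symbolAt q) us) t

  lookupB-zero : ∀ t → lookupB blank t zero ≡ headOr t
  lookupB-zero []      = refl
  lookupB-zero (_ ∷ _) = refl

  Shows-∷ : ∀ {q u a us t} → respAt q u ≡ passive a → Shows q us t → Shows q (u ∷ us) (a ∷ t)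
  Shows-∷ {q} {u} {a} {us} {t} u-passive (shows passives tape) =
    shows ((_ , u-passive) ∷ passives)
          (TapeEq-≡ (a ∷ t) (cong (_∷ map (symbolAt q) us) (cong symbolOf u-passive)) (TapeEq-∷ a _ t tape))

  Shows-uncons : ∀ {q u us t} → Shows q (u ∷ us) t →
                 respAt q u ≡ passive (headOr t) × Shows q us (List.drop 1 t)
  Shows-uncons {q} {u} {us} {t} (shows ((a , u-passive) ∷ passives) tape) =
    subst (λ x → respAt q u ≡ passive x) a≡head u-passive ,
    shows passives (TapeEq-drop (map (symbolAt q) (u ∷ us)) t tape)
    where
      a≡head : a ≡ headOr t
      a≡head = trans (cong symbolOf (sym u-passive)) (trans (tape zero) (lookupB-zero t))

  Shows-[] : ∀ {q t} → Shows q [] t → headOr t ≡ blank × Shows q [] (List.drop 1 t)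
  Shows-[] {t = t} (shows _ tape) = trans (sym (lookupB-zero t)) (sym (tape zero)) , shows [] (TapeEq-drop [] t tape)

  Shows-map : ∀ {q q′ us t} (h : Fin (QG.n q) → Fin (QG.n q′)) →
              All (λ u → QG.cfg q′ (h u) ≡ QG.cfg q u) us → Shows q us t → Shows q′ (map h us) t
  Shows-map {us = us} {t} h unchanged (shows passives tape) = shows
    (All.map⁺ (All.zipWith (λ { (eq , a , passive-a) → a , trans (cong (decode ∘ proj₂) eq) passive-a })
                           (unchanged , passives)))
    (TapeEq-≡ t (trans (sym (map-∘ us)) (map-cong-local (All.map (cong symOf) unchanged))) tape)

  Shows-overwrite : ∀ {q r z us t} → QG.focus q ∉ us → Shows q us t → Shows (overwrite q r z) us t
  Shows-overwrite {q} {r} {z} {us} {t} f∉us S =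
    subst (λ vs → Shows (overwrite q r z) vs t) (map-id us)
          (Shows-map id (All.tabulate (λ u∈us → overwrite-other q r z (λ { refl → f∉us u∈us }))) S)

  Shows-attach : ∀ {q v us t} → Shows q us t → Shows (attach q v) (map inject₁ us) t
  Shows-attach {q} {v} {us} = Shows-map inject₁ (All.universal (attach-old q v) us)

  record EncodesAt (q : QG) (c : Config M) (ls rs : List (Fin (QG.n q))) : Set where
    field
      shape  : Shape q ls rs
      atHead : respAt q (QG.focus q) ≡ active (state c) (head c)
      showsˡ : Shows q ls (left c)
      showsʳ : Shows q rs (right c)

  Encodes : QG → Config M → Set
  Encodes q c = ∃₂ (EncodesAt q c)

  respAt-other : ∀ q r z {u} → u ≢ QG.focus q → respAt (overwrite q r z) u ≡ respAt q u
  respAt-other q r z = cong (decode ∘ proj₂) ∘ overwrite-other q r z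

  viewAt-overwrite : ∀ q x z →
                     viewAt (overwrite q (encode x) z) (just (QG.focus q)) ≡ just (goalAt q (QG.focus q) , x)
  viewAt-overwrite q x z = cong just (cong₂ _,_ (overwrite-goal q _ z (QG.focus q)) (respAt-overwrite q x z))

  -- One step of M

  Enterable : Resp → Fin nΓ → Set
  Enterable r a = r ≡ passive a ⊎ (r ≡ fresh × a ≡ blank)

  enter-from-left : ∀ {r a g s b d} rv → Enterable r a →
                    decide r (just (g , trail s b d)) rv ≡ write (active s a) toLeft
  enter-from-left rv (inj₁ refl)          = refl
  enter-from-left rv (inj₂ (refl , refl)) = refl

  enter-from-right : ∀ {r a g s b d} lv → Enterable r a → trailState lv ≡ nothing →
                     decide r lv (just (g , trail s b d)) ≡ write (active s a) toRight
  enter-from-right lv (inj₁ refl)          no-trail rewrite no-trail = refl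
  enter-from-right lv (inj₂ (refl , refl)) no-trail rewrite no-trail = refl

  decide-active : ∀ {s a s′ b d} lv rv → accepting s ≡ false → δ s a ≡ just (s′ , b , d) →
                  decide (active s a) lv rv ≡ moveTo s′ b d (on d lv rv)
  decide-active lv rv running δ≡ rewrite running | δ≡ = refl

  passive-quiet : ∀ q us → All (IsPassive q) us → trailState (viewAt q (List.head us)) ≡ nothing
  passive-quiet q []      _                     = refl
  passive-quiet q (u ∷ _) ((_ , u-passive) ∷ _) = cong (λ r → trailState (just (_ , r))) u-passive

  handoff : (q₁ : QG) → Fin (QG.n q₁) → Transition → Fin nΓ → QG
  handoff q₁ z (s , b , d) a =
    let q₂ = overwrite q₁ (encode (trail s b d)) z
        q₃ = overwrite q₂ (encode (active s a)) (QG.focus q₁)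
    in  overwrite q₃ (encode (passive b)) z

  handoffʳ : ∀ {q₁ ls z rs s b a tl tr} → Shape q₁ ls (z ∷ rs) → Enterable (respAt q₁ z) a →
             Shows q₁ ls tl → Shows q₁ rs tr → step χ q₁ ≡ just (overwrite q₁ (encode (trail s b R)) z) →
             run χ q₁ 3 ≡ just (handoff q₁ z (s , b , R) a) ×
             EncodesAt (handoff q₁ z (s , b , R) a) (conf s (b ∷ tl) a tr) (QG.focus q₁ ∷ ls) rs
  handoffʳ {q₁} {ls} {z} {rs} {s} {b} {a} S₁ enterable Sˡ Sʳ step₁ = run₃ , record
    { shape  = S₄
    ; atHead = trans (respAt-other q₃ _ z z≢f) (respAt-overwrite q₂ (active s a) f)
    ; showsˡ = Shows-∷ (respAt-overwrite q₃ (passive b) z)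
                       (Shows-overwrite f∉ls (Shows-overwrite z∉ls (Shows-overwrite f∉ls Sˡ)))
    ; showsʳ = Shows-overwrite f∉rs (Shows-overwrite z∉rs (Shows-overwrite f∉rs Sʳ))
    }
    where
      f : Fin (QG.n q₁)
      f = QG.focus q₁
      q₂ q₃ q₄ : QG
      q₂ = overwrite q₁ (encode (trail s b R)) z
      q₃ = overwrite q₂ (encode (active s a)) f
      q₄ = handoff q₁ z (s , b , R) a
      S₂ : Shape q₂ (f ∷ ls) rs
      S₂ = Shape-moveRight (encode (trail s b R)) S₁
      S₃ : Shape q₃ ls (z ∷ rs)
      S₃ = Shape-moveLeft (encode (active s a)) S₂
      S₄ : Shape q₄ (f ∷ ls) rs
      S₄ = Shape-moveRight (encode (passive b)) S₃
      f∉ls : f ∉ ls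
      f∉ls = focus∉ˡ (path (layout S₁))
      f∉rs : f ∉ rs
      f∉rs = focus∉ʳ (path (layout S₁)) ∘ there
      z∉ls : z ∉ ls
      z∉ls = focus∉ˡ (path (layout S₄)) ∘ there
      z∉rs : z ∉ rs
      z∉rs = focus∉ʳ (path (layout S₄))
      z≢f : z ≢ f
      z≢f z≡f = focus∉ʳ (path (layout S₁)) (here (sym z≡f))
      step₂ : step χ q₂ ≡ just q₃
      step₂ = step-by _ S₂ (trans (cong₂ (λ r v → decide r v (viewAt q₂ (List.head rs)))
                                         (respAt-other q₁ _ z z≢f) (viewAt-overwrite q₁ (trail s b R) z))
                                  (enter-from-left _ enterable))
      step₃ : step χ q₃ ≡ just q₄
      step₃ = step-by _ S₃ (cong (λ r → decide r (viewAt q₃ (List.head ls)) (viewAt q₃ (just z)))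
                                 (trans (respAt-other q₂ _ f (z≢f ∘ sym)) (respAt-overwrite q₁ (trail s b R) z)))
      run₃ : run χ q₁ 3 ≡ just q₄
      run₃ = trans (run-step χ 2 step₁) (trans (run-step χ 1 step₂) (run-step χ 0 step₃))

  handoffˡ : ∀ {q₁ z ls rs s b a tl tr} → Shape q₁ (z ∷ ls) rs → Enterable (respAt q₁ z) a →
             Shows q₁ ls tl → Shows q₁ rs tr → step χ q₁ ≡ just (overwrite q₁ (encode (trail s b L)) z) →
             run χ q₁ 3 ≡ just (handoff q₁ z (s , b , L) a) ×
             EncodesAt (handoff q₁ z (s , b , L) a) (conf s tl a (b ∷ tr)) ls (QG.focus q₁ ∷ rs)
  handoffˡ {q₁} {z} {ls} {rs} {s} {b} {a} {tl} S₁ enterable Sˡ Sʳ step₁ = run₃ , record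
    { shape  = S₄
    ; atHead = trans (respAt-other q₃ _ z z≢f) (respAt-overwrite q₂ (active s a) f)
    ; showsˡ = Shows-overwrite f∉ls (Shows-overwrite z∉ls Sˡ₂)
    ; showsʳ = Shows-∷ (respAt-overwrite q₃ (passive b) z)
                       (Shows-overwrite f∉rs (Shows-overwrite z∉rs (Shows-overwrite f∉rs Sʳ)))
    }
    where
      f : Fin (QG.n q₁)
      f = QG.focus q₁
      q₂ q₃ q₄ : QG
      q₂ = overwrite q₁ (encode (trail s b L)) z
      q₃ = overwrite q₂ (encode (active s a)) f
      q₄ = handoff q₁ z (s , b , L) a
      S₂ : Shape q₂ ls (f ∷ rs)
      S₂ = Shape-moveLeft (encode (trail s b L)) S₁
      S₃ : Shape q₃ (z ∷ ls) rs
      S₃ = Shape-moveRight (encode (active s a)) S₂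
      S₄ : Shape q₄ ls (f ∷ rs)
      S₄ = Shape-moveLeft (encode (passive b)) S₃
      f∉ls : f ∉ ls
      f∉ls = focus∉ˡ (path (layout S₁)) ∘ there
      f∉rs : f ∉ rs
      f∉rs = focus∉ʳ (path (layout S₁))
      z∉ls : z ∉ ls
      z∉ls = focus∉ˡ (path (layout S₄))
      z∉rs : z ∉ rs
      z∉rs = focus∉ʳ (path (layout S₄)) ∘ there
      z≢f : z ≢ f
      z≢f z≡f = focus∉ˡ (path (layout S₁)) (here (sym z≡f))
      Sˡ₂ : Shows q₂ ls tl
      Sˡ₂ = Shows-overwrite f∉ls Sˡ
      step₂ : step χ q₂ ≡ just q₃
      step₂ = step-by _ S₂ (trans (cong₂ (λ r v → decide r (viewAt q₂ (List.head ls)) v)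
                                         (respAt-other q₁ _ z z≢f) (viewAt-overwrite q₁ (trail s b L) z))
                                  (enter-from-right _ enterable (passive-quiet q₂ ls (Shows.passives Sˡ₂))))
      step₃ : step χ q₃ ≡ just q₄
      step₃ = step-by _ S₃ (cong (λ r → decide r (viewAt q₃ (just z)) (viewAt q₃ (List.head rs)))
                                 (trans (respAt-other q₂ _ f (z≢f ∘ sym)) (respAt-overwrite q₁ (trail s b L) z)))
      run₃ : run χ q₁ 3 ≡ just q₄
      run₃ = trans (run-step χ 2 step₁) (trans (run-step χ 1 step₂) (run-step χ 0 step₃))

  Reaches : ℕ → QG → Config M → Set
  Reaches t q c = ∃ λ q′ → run χ q t ≡ just q′ × Encodes q′ c

  step-head : ∀ {q c ls rs} d → EncodesAt q c ls rs →
              decide (active (state c) (head c)) (viewAt q (List.head ls)) (viewAt q (List.head rs)) ≡ d →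
              step χ q ≡ perform q (List.head ls) (List.head rs) d
  step-head {q} {ls = ls} {rs} d E decided =
    step-by d shape
      (trans (cong (λ r → decide r (viewAt q (List.head ls)) (viewAt q (List.head rs))) atHead) decided)
    where open EncodesAt E

  Reaches-step : ∀ {q q₁ q₄ c ls rs} → step χ q ≡ just q₁ →
                 run χ q₁ 3 ≡ just q₄ × EncodesAt q₄ c ls rs → Reaches 4 q c
  Reaches-step stepped (ran , E) = _ , trans (run-step χ 3 stepped) ran , _ , _ , E

  moveRight-existing : ∀ {q c ls z rs s′ b} → EncodesAt q c ls (z ∷ rs) → accepting (state c) ≡ false →
                       δ (state c) (head c) ≡ just (s′ , b , R) → Reaches 4 q (moveHead s′ b R c)
  moveRight-existing {q} {c} {ls} {z} {rs} {s′} {b} E running δ≡ =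
    Reaches-step step₁ (handoffʳ (Shape-stay _ shape) (inj₁ (trans (respAt-other q _ f z≢f) z-passive))
                                 (Shows-overwrite f∉ls showsˡ)
                                 (Shows-overwrite (f∉zrs ∘ there) (proj₂ (Shows-uncons showsʳ))) step₂)
    where
      open EncodesAt E
      f : Fin (QG.n q)
      f = QG.focus q
      q₁ : QG
      q₁ = overwrite q (encode (marked s′ b R)) f
      f∉ls : f ∉ ls
      f∉ls = focus∉ˡ (path (layout shape))
      f∉zrs : f ∉ z ∷ rs
      f∉zrs = focus∉ʳ (path (layout shape))
      z≢f : z ≢ f
      z≢f z≡f = f∉zrs (here (sym z≡f))
      z-passive : respAt q z ≡ passive (headOr (right c))
      z-passive = proj₁ (Shows-uncons showsʳ)
      step₁ : step χ q ≡ just q₁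
      step₁ = step-head _ E (trans (decide-active _ _ running δ≡)
                                   (cong (λ r → moveTo s′ b R (just (goalAt q z , r))) z-passive))
      step₂ : step χ q₁ ≡ just (overwrite q₁ (encode (trail s′ b R)) z)
      step₂ = step-by _ (Shape-stay _ shape)
                (cong (λ r → decide r (viewAt q₁ (List.head ls)) (viewAt q₁ (just z)))
                      (respAt-overwrite q (marked s′ b R) f))

  moveLeft-existing : ∀ {q c z ls rs s′ b} → EncodesAt q c (z ∷ ls) rs → accepting (state c) ≡ false →
                      δ (state c) (head c) ≡ just (s′ , b , L) → Reaches 4 q (moveHead s′ b L c)
  moveLeft-existing {q} {c} {z} {ls} {rs} {s′} {b} E running δ≡ =
    Reaches-step step₁ (handoffˡ (Shape-stay _ shape) (inj₁ (trans (respAt-other q _ f z≢f) z-passive))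
                                 (Shows-overwrite (f∉zls ∘ there) (proj₂ (Shows-uncons showsˡ)))
                                 (Shows-overwrite f∉rs showsʳ) step₂)
    where
      open EncodesAt E
      f : Fin (QG.n q)
      f = QG.focus q
      q₁ : QG
      q₁ = overwrite q (encode (marked s′ b L)) f
      f∉zls : f ∉ z ∷ ls
      f∉zls = focus∉ˡ (path (layout shape))
      f∉rs : f ∉ rs
      f∉rs = focus∉ʳ (path (layout shape))
      z≢f : z ≢ f
      z≢f z≡f = f∉zls (here (sym z≡f))
      z-passive : respAt q z ≡ passive (headOr (left c))
      z-passive = proj₁ (Shows-uncons showsˡ)
      step₁ : step χ q ≡ just q₁
      step₁ = step-head _ E (trans (decide-active _ _ running δ≡)
                                   (cong (λ r → moveTo s′ b L (just (goalAt q z , r))) z-passive))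
      step₂ : step χ q₁ ≡ just (overwrite q₁ (encode (trail s′ b L)) z)
      step₂ = step-by _ (Shape-stay _ shape)
                (cong (λ r → decide r (viewAt q₁ (just z)) (viewAt q₁ (List.head rs)))
                      (respAt-overwrite q (marked s′ b L) f))

  module _ (q : QG) (g : Goal) where

    respAt-new : respAt (attach q (g , encode fresh)) (fromℕ (QG.n q)) ≡ fresh
    respAt-new = trans (cong (decode ∘ proj₂) (attach-new q _)) (decode-encode fresh)

    respAt-old : ∀ u → respAt (attach q (g , encode fresh)) (inject₁ u) ≡ respAt q u
    respAt-old u = cong (decode ∘ proj₂) (attach-old q _ u)

  moveRight-new : ∀ {q c ls s′ b} → EncodesAt q c ls [] → accepting (state c) ≡ false →
                  δ (state c) (head c) ≡ just (s′ , b , R) → Reaches 4 q (moveHead s′ b R c)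
  moveRight-new {q} {c} {ls} {s′} {b} E running δ≡ =
    Reaches-step (step-head _ E (decide-active _ _ running δ≡))
                 (handoffʳ S₁ (inj₂ (respAt-new q rightExt , proj₁ (Shows-[] showsʳ)))
                              (Shows-attach showsˡ) (Shows-attach (proj₂ (Shows-[] showsʳ))) step₂)
    where
      open EncodesAt E
      q₁ : QG
      q₁ = attach q (rightExt , encode fresh)
      new : Fin (QG.n q₁)
      new = fromℕ (QG.n q)
      S₁ : Shape q₁ (map inject₁ ls) [ new ]
      S₁ = Shape-extendʳ q _ refl shape
      step₂ : step χ q₁ ≡ just (overwrite q₁ (encode (trail s′ b R)) new)
      step₂ = step-by _ S₁
                (trans (cong₂ (λ r x → decide r (viewAt q₁ (List.head (map inject₁ ls))) (just (goalAt q₁ new , x)))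
                              (trans (respAt-old q rightExt (QG.focus q)) atHead) (respAt-new q rightExt))
                       (decide-active _ _ running δ≡))

  moveLeft-new : ∀ {q c rs s′ b} → EncodesAt q c [] rs → accepting (state c) ≡ false →
                 δ (state c) (head c) ≡ just (s′ , b , L) → Reaches 4 q (moveHead s′ b L c)
  moveLeft-new {q} {c} {rs} {s′} {b} E running δ≡ =
    Reaches-step (step-head _ E (decide-active _ _ running δ≡))
                 (handoffˡ S₁ (inj₂ (respAt-new q leftExt , proj₁ (Shows-[] showsˡ)))
                              (Shows-attach (proj₂ (Shows-[] showsˡ))) (Shows-attach showsʳ) step₂)
    where
      open EncodesAt E
      q₁ : QG
      q₁ = attach q (leftExt , encode fresh)
      new : Fin (QG.n q₁)
      new = fromℕ (QG.n q)
      S₁ : Shape q₁ [ new ] (map inject₁ rs)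
      S₁ = Shape-extendˡ q _ refl (subst (GoalStep leftExt) (sym (leftEnd shape)) left-left) (layout shape)
      step₂ : step χ q₁ ≡ just (overwrite q₁ (encode (trail s′ b L)) new)
      step₂ = step-by _ S₁
                (trans (cong₂ (λ r x → decide r (just (goalAt q₁ new , x)) (viewAt q₁ (List.head (map inject₁ rs))))
                              (trans (respAt-old q leftExt (QG.focus q)) atHead) (respAt-new q leftExt))
                       (decide-active _ _ running δ≡))

  Encodes-move : ∀ {q c s′ b d} → Encodes q c → accepting (state c) ≡ false →
                 δ (state c) (head c) ≡ just (s′ , b , d) → Reaches 4 q (moveHead s′ b d c)
  Encodes-move {d = R} (ls , []    , E) = moveRight-new E
  Encodes-move {d = R} (ls , _ ∷ _ , E) = moveRight-existing E
  Encodes-move {d = L} ([]    , rs , E) = moveLeft-new E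
  Encodes-move {d = L} (_ ∷ _ , rs , E) = moveLeft-existing E

  Encodes-halt : ∀ {q c} → Encodes q c → accepting (state c) ≡ true → step χ q ≡ nothing
  Encodes-halt (_ , _ , E) accepts = step-head halt E (halts accepts)
    where
      halts : ∀ {s a lv rv} → accepting s ≡ true → decide (active s a) lv rv ≡ halt
      halts accepts rewrite accepts = refl

  Encodes-stuck : ∀ {q c} → Encodes q c → accepting (state c) ≡ false →
                  δ (state c) (head c) ≡ nothing → ∃ λ q′ → step χ q ≡ just q′ × Encodes q′ c
  Encodes-stuck {q} {c} (ls , rs , E) running stuck = _ , step-head _ E (spins running stuck) , ls , rs , record
    { shape  = Shape-stay _ shape
    ; atHead = respAt-overwrite q (active (state c) (head c)) (QG.focus q)
    ; showsˡ = Shows-overwrite (focus∉ˡ (path (layout shape))) showsˡ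
    ; showsʳ = Shows-overwrite (focus∉ʳ (path (layout shape))) showsʳ
    }
    where
      open EncodesAt E
      spins : ∀ {s a lv rv} → accepting s ≡ false → δ s a ≡ nothing →
              decide (active s a) lv rv ≡ write (active s a) stay
      spins running stuck rewrite running | stuck = refl

  Encodes-runs-forever : ∀ {q c} → Encodes q c → accepting (state c) ≡ false →
                         δ (state c) (head c) ≡ nothing → ∀ j → run χ q j ≢ nothing
  Encodes-runs-forever E running stuck zero    ()
  Encodes-runs-forever E running stuck (suc j) stopped with Encodes-stuck E running stuck
  ... | q′ , stepped , E′ = Encodes-runs-forever E′ running stuck j (trans (sym (run-step χ j stepped)) stopped)

  open Simulation M 2 3 nR using (Represents; Simulates)

  Encodes⇒Represents : ∀ {q c} → Encodes q c → Represents symOf stOf q c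
  Encodes⇒Represents {q} (ls , rs , E) =
    ls , rs , unique P ,
    Path-from (QG.edges q) (QG.focus q ∷ ls) (from (edges⇔ P) ∘ inj₁ ∘ inj₁) ,
    Path-from (QG.edges q) (QG.focus q ∷ rs) (from (edges⇔ P) ∘ inj₂ ∘ inj₁) ,
    cong stateOf atHead , cong symbolOf atHead , Shows.tape showsˡ , Shows.tape showsʳ
    where
      open EncodesAt E
      P : SimplePath (QG.edges q) (QG.focus q) ls rs
      P = path (layout shape)

  stepTM-move : ∀ {c s′ b d} → accepting (state c) ≡ false → δ (state c) (head c) ≡ just (s′ , b , d) →
                stepTM c ≡ just (moveHead s′ b d c)
  stepTM-move running δ≡ rewrite running | δ≡ = refl

  stepTM-just⁻ : ∀ c {c′} → stepTM c ≡ just c′ →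
                 accepting (state c) ≡ false × ∃ λ t → δ (state c) (head c) ≡ just t ×
                 c′ ≡ moveHead (proj₁ t) (proj₁ (proj₂ t)) (proj₂ (proj₂ t)) c
  stepTM-just⁻ c stepped with accepting (state c) | δ (state c) (head c)
  stepTM-just⁻ c refl | false | just t = refl , t , refl , refl

  -- The run on an input

  module OnInput (w : List (Fin nΓ)) where

    q₀ : QG
    q₀ = chain initCfg (headOr w) (List.drop 1 w)

    private
      a : Fin nΓ
      a = headOr w

      m : ℕ
      m = List.length (List.drop 1 w)

      v : 𝒱
      v = leftExt , encode (passive blank)

      q₁ q₂ : QG
      q₁ = attach q₀ v
      q₂ = overwrite q₁ (encode (active s₀ a)) (inject₁ zero)

      new : Fin (suc (suc m))
      new = fromℕ (suc m)

      chain-passive : ∀ u → respAt q₀ u ≡ passive (Vec.lookup (a ∷ Vec.fromList (List.drop 1 w)) u)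
      chain-passive u = decode-encode (passive _)

      chain-quiet : ∀ p → trailState (viewAt q₀ p) ≡ nothing × isLeftExt (viewAt q₀ p) ≡ false
      chain-quiet nothing  = refl , refl
      chain-quiet (just u) = cong (λ r → trailState (just (inChain , r))) (chain-passive u) , refl

      explore : ∀ lv rv → trailState lv ≡ nothing × isLeftExt lv ≡ false →
                trailState rv ≡ nothing × isLeftExt rv ≡ false →
                decide (passive a) lv rv ≡ extend leftExt (passive blank)
      explore lv rv (tl , el) (tr , er) rewrite tl | tr | el | er = refl

      place : ∀ rv → trailState rv ≡ nothing →
              decide (passive a) (just (leftExt , passive blank)) rv ≡ write (active s₀ a) stay
      place rv tr rewrite tr = refl

      step₁ : step χ q₀ ≡ just q₁
      step₁ = trans (step-χ q₀) (cong (perform q₀ _ _) (explores (sideNodes q₀)))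
        where
          explores : ∀ p → decideAt q₀ p ≡ extend leftExt (passive blank)
          explores (l , r) = trans (cong (λ x → decide x (viewAt q₀ l) (viewAt q₀ r)) (chain-passive zero))
                                   (explore _ _ (chain-quiet l) (chain-quiet r))

      S₁ : Shape q₁ [ new ] (map inject₁ (tabulate suc))
      S₁ = Shape-extendˡ q₀ v refl left-chain (Layout-chain m)

      shows₀ : Shows q₀ (tabulate suc) (List.drop 1 w)
      shows₀ = shows (All.tabulate⁺ (λ i → _ , chain-passive (suc i)))
                     (TapeEq-≡ (List.drop 1 w) symbols (λ _ → refl))
        where
          open ≡-Reasoning
          symbols : map (symbolAt q₀) (tabulate suc) ≡ List.drop 1 w
          symbols = begin
            map (symbolAt q₀) (tabulate suc)
              ≡⟨ map-tabulate suc (symbolAt q₀) ⟩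
            tabulate (symbolAt q₀ ∘ suc)
              ≡⟨ tabulate-cong (λ i → trans (cong symbolOf (chain-passive (suc i)))
                                              (lookup-fromList (List.drop 1 w) i)) ⟩
            tabulate (List.lookup (List.drop 1 w))
              ≡⟨ tabulate-lookup (List.drop 1 w) ⟩
            List.drop 1 w
              ∎

      shows₁ : Shows q₁ (map inject₁ (tabulate suc)) (List.drop 1 w)
      shows₁ = Shows-attach shows₀

      new-blank : respAt q₁ new ≡ passive blank
      new-blank = trans (cong (decode ∘ proj₂) (attach-new q₀ v)) (decode-encode (passive blank))

      step₂ : step χ q₁ ≡ just q₂
      step₂ = step-by _ S₁
                (trans (cong₂ (λ r lv → decide r lv (viewAt q₁ (List.head (map inject₁ (tabulate suc)))))
                              (trans (cong (decode ∘ proj₂) (attach-old q₀ v zero)) (chain-passive zero))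
                              (trans (cong (just ∘ viewOf) (attach-new q₀ v))
                                     (cong (λ r → just (leftExt , r)) (decode-encode (passive blank)))))
                       (place _ (passive-quiet q₁ _ (Shows.passives shows₁))))

    started : Reaches 2 q₀ (initConfig w)
    started = q₂ , trans (run-step χ 1 step₁) (run-step χ 0 step₂) ,
              [ new ] , map inject₁ (tabulate suc) , record
      { shape  = Shape-stay _ S₁
      ; atHead = respAt-overwrite q₁ (active s₀ a) (inject₁ zero)
      ; showsˡ = shows ((blank , new-blank′) ∷ []) (λ { zero → cong symbolOf new-blank′ ; (suc _) → refl })
      ; showsʳ = Shows-overwrite (focus∉ʳ (path (layout S₁))) shows₁
      }
      where
        new-blank′ : respAt q₂ new ≡ passive blank
        new-blank′ = trans (respAt-other q₁ (encode (active s₀ a)) (inject₁ zero) fromℕ≢inject₁) new-blank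

    τ : ℕ → ℕ
    τ zero    = 2
    τ (suc k) = 4 + τ k

    τ-strictMono : ∀ k → τ k ℕ.< τ (suc k)
    τ-strictMono k = ℕₚ.m<n+m (τ k) (s≤s z≤n)

    reaches : ∀ k {c} → tmAt w k ≡ just c → Reaches (τ k) q₀ c
    reaches zero    refl = started
    reaches (suc k) tm≡ with tmAt w k in tm≡₀
    ... | just c₀ with stepTM-just⁻ c₀ tm≡ | reaches k tm≡₀
    ... | running , _ , δ≡ , refl | q , ran , E with Encodes-move E running δ≡
    ... | q′ , ran′ , E′ = q′ , trans (run-+-just χ {t = τ k} 4 ran) ran′ , E′

    Accepts : Set
    Accepts = ∃₂ λ k c → tmAt w k ≡ just c × accepting (state c) ≡ true

    accepts⇒stops : Accepts → ∃ λ T → run χ q₀ T ≡ nothing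
    accepts⇒stops (k , c , tm≡ , accepts) with reaches k tm≡
    ... | q , ran , E = suc (τ k) , trans (cong (_>>= step χ) ran) (Encodes-halt E accepts)

    StopsWithin : ℕ → Set
    StopsWithin j = ∀ k {q c} → tmAt w k ≡ just c → Encodes q c → run χ q j ≡ nothing → Accepts

    -- unless c accepts, the run reaches an encoding of the next configuration of M
    -- after 4 steps and must stop within j ∸ 4 steps from there
    stopsWithin : ∀ j → StopsWithin j
    stopsWithin = <-rec StopsWithin stopsWithin-step
      where
        stopsWithin-step : ∀ j → (∀ {j′} → j′ ℕ.< j → StopsWithin j′) → StopsWithin j
        stopsWithin-step j rec k {q} {c} tm≡ E stopped
          with accepting (state c) in acc | δ (state c) (head c) in δ≡
        ... | true  | _       = k , c , tm≡ , acc
        ... | false | nothing = ⊥-elim (Encodes-runs-forever E acc δ≡ j stopped)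
        ... | false | just (s′ , b , d) with Encodes-move E acc δ≡
        ... | q′ , ran , E′ with run-after χ q 4 j ran stopped
        ... | j′ , refl , stopped′ =
          rec (ℕₚ.m<m+n j′ (s≤s z≤n)) (suc k) (trans (cong (_>>= stepTM) tm≡) (stepTM-move acc δ≡))
              E′ stopped′

    stops⇒accepts : (∃ λ T → run χ q₀ T ≡ nothing) → Accepts
    stops⇒accepts (T , stopped) with started
    ... | _ , ran , E with run-after χ q₀ 2 T ran stopped
    ... | j , _ , stopped′ = stopsWithin j 0 refl E stopped′

    represented : ∀ k c → tmAt w k ≡ just c →
                  ∃ λ q → run χ q₀ (τ k) ≡ just q × Represents symOf stOf q c
    represented k c tm≡ with reaches k tm≡
    ... | q , ran , E = q , ran , Encodes⇒Represents E

  -- every tape is simulated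
  simulates : Simulates χ initCfg symOf stOf
  simulates w _ = τ , τ-strictMono , represented , mk⇔ stops⇒accepts accepts⇒stops
    where open OnInput w

mainTheorem1 : (M : TM) → TuringSimulable M
mainTheorem1 M = 3 , nR , χ , initCfg , symOf , stOf , simulates
  where open Construction M
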